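{- Let $f:\{0,1\}^n\to\{0,1\}$ be an arbitrary symmetric Boolean function. Then \[ D(f) \le O\!\left(\max\{\mathsf{N}(f)^6,\mathsf{N}(\overline{f})^6\}\right). \]
   Context: $f$ is symmetric if $f(x)$ depends only on the Hamming weight $|x|$. $\mathsf{N}(f)$ is the minimum degree of a real polynomial $p$ with $|p(x)|\le 1/3$ whenever $f(x)=0$ and $|p(x)|\ge 1$ whenever $f(x)=1$ ($x\in\{0,1\}^n$); $\overline f=1-f$. $D(f)$ is deterministic decision tree complexity. The $O(\cdot)$ hides an absolute constant.
   Formalization: The polynomials in the definitions of $\mathsf{N}(f)$ and $\mathsf{N}(\overline{f})$ have rational coefficients instead of real ones. -}

module Defs where

open import Data.Bool using (Bool; true; false; if_then_else_; not)
open import Data.Nat as ℕ using (ℕ; zero; suc; _⊔_)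
open import Data.Fin using (Fin)
open import Data.Vec using (Vec; []; _∷_; lookup; count)
open import Data.List using (List; []; _∷_; map; _++_; foldr)
open import Data.Integer using (+_)
open import Data.Rational using (ℚ; 0ℚ; 1ℚ; _+_; _*_; ∣_∣; _≤_; _/_; -_)
open import Relation.Binary.PropositionalEquality using (_≡_)
open import Relation.Nullary using (T?)

-- Boolean inputs x ∈ {0,1}^n, encoded as Vec Bool n (true = 1).
Input : ℕ → Set
Input n = Vec Bool n

BoolFun : ℕ → Set
BoolFun n = Input n → Bool

weight : ∀ {n} → Input n → ℕ
weight x = count T? x

Symmetric : ∀ {n} → BoolFun n → Set
Symmetric {n} f = (x y : Input n) → weight x ≡ weight y → f x ≡ f y

complement : ∀ {n} → BoolFun n → BoolFun n
complement f x = not (f x)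

-- all subsets S ⊆ [n], as characteristic vectors
allSubsets : (n : ℕ) → List (Vec Bool n)
allSubsets zero = [] ∷ []
allSubsets (suc n) = map (false ∷_) (allSubsets n) ++ map (true ∷_) (allSubsets n)

toℚ : Bool → ℚ
toℚ true = 1ℚ
toℚ false = 0ℚ

monomial : ∀ {n} → Vec Bool n → Input n → ℚ
monomial [] [] = 1ℚ
monomial (true ∷ S) (b ∷ x) = toℚ b * monomial S x
monomial (false ∷ S) (b ∷ x) = monomial S x

Poly : ℕ → Set
Poly n = Vec Bool n → ℚ

evalPoly : ∀ {n} → Poly n → Input n → ℚ
evalPoly {n} c x = foldr (λ S acc → c S * monomial S x + acc) 0ℚ (allSubsets n)

DegreeAtMost : ∀ {n} → ℕ → Poly n → Set
DegreeAtMost {n} d c = (S : Vec Bool n) → d ℕ.< weight S → c S ≡ 0ℚ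

NRepresents : ∀ {n} → Poly n → BoolFun n → Set
NRepresents {n} p f =
  (x : Input n) →
    (f x ≡ false → ∣ evalPoly p x ∣ ≤ (+ 1 / 3)) ×' (f x ≡ true → 1ℚ ≤ ∣ evalPoly p x ∣)
  where
    open import Data.Product using () renaming (_×_ to _×'_)

NDegAtMost : ∀ {n} → BoolFun n → ℕ → Set
NDegAtMost {n} f d = Data.Product.Σ (Poly n) (λ p → DegreeAtMost d p Data.Product.× NRepresents p f)
  where import Data.Product

data DTree (n : ℕ) : Set where
  leaf : Bool → DTree n
  query : Fin n → DTree n → DTree n → DTree n   -- query x_i: (branch if 0) (branch if 1)

runTree : ∀ {n} → DTree n → Input n → Bool
runTree (leaf b) x = b
runTree (query i t₀ t₁) x = if lookup x i then runTree t₁ x else runTree t₀ x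

depth : ∀ {n} → DTree n → ℕ
depth (leaf _) = 0
depth (query _ t₀ t₁) = suc (depth t₀ ⊔ depth t₁)

Computes : ∀ {n} → DTree n → BoolFun n → Set
Computes {n} t f = (x : Input n) → runTree t x ≡ f x

DAtMost : ∀ {n} → BoolFun n → ℕ → Set
DAtMost {n} f k = Data.Product.Σ (DTree n) (λ t → Computes t f Data.Product.× depth t ℕ.≤ k)
  where import Data.Product

{-# OPTIONS --safe #-}
module Submission where

-- Let p and q N-represent f and its complement with degree ≤ d. Averaging p² and q² over the inputs
-- of each weight (Minsky–Papert) gives univariate polynomials P, Q of degree ≤ 2d such that at a weight
-- where f = 1 we have P ≥ 1 and 0 ≤ Q ≤ 1/9, and symmetrically where f = 0. So P − Q has the sign of f
-- along 0, …, n, and f changes value at most 2d times. If f takes one value at a weight L and the other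
-- at all weights L + σm² with 1 ≤ m ≤ N (σ = ±1), let G ∈ {P, Q} be the polynomial that is ≥ 1 at L.
-- The (2N)-th finite difference of u ↦ G(L + σu²)^(2d+1) at −N vanishes, and its central term
-- dominates the others unless 1 ≤ (2N+1)/9^(2d+1), which fails for N = 1 + (2d+1)·2d. Hence every run
-- of f adjacent to a change is shorter than N², so a non-constant f has n < (2d+1)N² = O(d⁶), and
-- querying all variables suffices.

module RationalArithmetic where

  open import Algebra.Bundles using (CommutativeRing)
  open import Data.Empty using (⊥-elim)
  open import Data.Integer using (+≤+; +<+)
  open import Data.Nat as ℕ using (ℕ; zero; suc; z≤n; s≤s)
  import Data.Nat.Properties as ℕ
  open import Data.Rational
  open import Data.Rational.Properties
  open import Data.Rational.Solver using (module +-*-Solver)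
  open import Data.Sum using (inj₁; inj₂)
  open import Function using (_∘_)
  open import Relation.Binary.PropositionalEquality
  open import Relation.Nullary using (yes; no)
  open +-*-Solver using (solve; _:=_; _:+_; _:*_; _:-_; :-_; con)
  open import Algebra.Definitions.RawMonoid +-0-rawMonoid using (_×_)
  open import Algebra.Definitions.RawSemiring +-*-rawSemiring public using (_^_)
  open import Algebra.Properties.CommutativeSemiring.Exp (CommutativeRing.commutativeSemiring +-*-commutativeRing) public
    using (^-distrib-*)
  import Algebra.Properties.Monoid.Mult +-0-monoid as Mult
  import Algebra.Properties.Semiring.Mult (CommutativeRing.semiring +-*-commutativeRing) as SemiringMult

  -- ⟦ suc n ⟧ reduces to 1ℚ + ⟦ n ⟧; the proofs below rely on this.
  ⟦_⟧ : ℕ → ℚ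
  ⟦ n ⟧ = n × 1ℚ

  ⟦⟧-homo-+ : ∀ m n → ⟦ m ℕ.+ n ⟧ ≡ ⟦ m ⟧ + ⟦ n ⟧
  ⟦⟧-homo-+ = Mult.×-homo-+ 1ℚ

  ⟦⟧-homo-* : ∀ m n → ⟦ m ℕ.* n ⟧ ≡ ⟦ m ⟧ * ⟦ n ⟧
  ⟦⟧-homo-* = SemiringMult.×1-homo-*

  ⟦⟧-homo-∸ : ∀ {a b} → b ℕ.≤ a → ⟦ a ℕ.∸ b ⟧ + ⟦ b ⟧ ≡ ⟦ a ⟧
  ⟦⟧-homo-∸ {a} {b} b≤a = trans (sym (⟦⟧-homo-+ (a ℕ.∸ b) b)) (cong ⟦_⟧ (ℕ.m∸n+n≡m b≤a))

  ⟦suc⟧-1 : ∀ n → ⟦ suc n ⟧ - 1ℚ ≡ ⟦ n ⟧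
  ⟦suc⟧-1 n = solve 1 (λ n → con 1ℚ :+ n :- con 1ℚ := n) refl ⟦ n ⟧

  0≤1 : 0ℚ ≤ 1ℚ
  0≤1 = *≤* (+≤+ z≤n)

  0<1 : 0ℚ < 1ℚ
  0<1 = *<* (+<+ (s≤s z≤n))

  p≤p+q : ∀ {p q} → 0ℚ ≤ q → p ≤ p + q
  p≤p+q {p} 0≤q = ≤-trans (≤-reflexive (sym (+-identityʳ p))) (+-monoʳ-≤ p 0≤q)

  ⟦⟧-nonNeg : ∀ n → 0ℚ ≤ ⟦ n ⟧
  ⟦⟧-nonNeg zero = ≤-refl
  ⟦⟧-nonNeg (suc n) = ≤-trans 0≤1 (p≤p+q (⟦⟧-nonNeg n))

  ⟦suc⟧-pos : ∀ n → 0ℚ < ⟦ suc n ⟧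
  ⟦suc⟧-pos n = <-≤-trans 0<1 (p≤p+q (⟦⟧-nonNeg n))

  ⟦⟧-mono-≤ : ∀ {m n} → m ℕ.≤ n → ⟦ m ⟧ ≤ ⟦ n ⟧
  ⟦⟧-mono-≤ {n = n} z≤n = ⟦⟧-nonNeg n
  ⟦⟧-mono-≤ (s≤s m≤n) = +-monoʳ-≤ 1ℚ (⟦⟧-mono-≤ m≤n)

  ⟦⟧-mono-< : ∀ {m n} → m ℕ.< n → ⟦ m ⟧ < ⟦ n ⟧
  ⟦⟧-mono-< {zero} {suc n} _ = ⟦suc⟧-pos n
  ⟦⟧-mono-< {suc m} {suc n} (s≤s m<n) = +-monoʳ-< 1ℚ (⟦⟧-mono-< m<n)

  ⟦⟧-cancel-≤ : ∀ {m n} → ⟦ m ⟧ ≤ ⟦ n ⟧ → m ℕ.≤ n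
  ⟦⟧-cancel-≤ {m} {n} ⟦m⟧≤⟦n⟧ with ℕ.≤-<-connex m n
  ... | inj₁ m≤n = m≤n
  ... | inj₂ n<m = ⊥-elim (<-irrefl refl (<-≤-trans (⟦⟧-mono-< n<m) ⟦m⟧≤⟦n⟧))

  ⟦⟧-injective : ∀ {m n} → ⟦ m ⟧ ≡ ⟦ n ⟧ → m ≡ n
  ⟦⟧-injective eq = ℕ.≤-antisym (⟦⟧-cancel-≤ (≤-reflexive eq)) (⟦⟧-cancel-≤ (≤-reflexive (sym eq)))

  *-monoˡ-≤-≥0 : ∀ {r p q} → 0ℚ ≤ r → p ≤ q → r * p ≤ r * q
  *-monoˡ-≤-≥0 {r} 0≤r = *-monoˡ-≤-nonNeg r {{nonNegative 0≤r}}

  *-monoʳ-≤-≥0 : ∀ {r p q} → 0ℚ ≤ r → p ≤ q → p * r ≤ q * r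
  *-monoʳ-≤-≥0 {r} 0≤r = *-monoʳ-≤-nonNeg r {{nonNegative 0≤r}}

  *-cancelˡ-≤->0 : ∀ {r p q} → 0ℚ < r → r * p ≤ r * q → p ≤ q
  *-cancelˡ-≤->0 {r} 0<r = *-cancelˡ-≤-pos r {{positive 0<r}}

  *-cancelˡ->0 : ∀ {r p q} → 0ℚ < r → r * p ≡ r * q → p ≡ q
  *-cancelˡ->0 0<r eq = ≤-antisym (*-cancelˡ-≤->0 0<r (≤-reflexive eq)) (*-cancelˡ-≤->0 0<r (≤-reflexive (sym eq)))

  *-≥0 : ∀ {p q} → 0ℚ ≤ p → 0ℚ ≤ q → 0ℚ ≤ p * q
  *-≥0 {p} {q} 0≤p 0≤q = ≤-trans (≤-reflexive (sym (*-zeroˡ q))) (*-monoʳ-≤-≥0 0≤q 0≤p)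

  p-p≡0 : ∀ p → p - p ≡ 0ℚ
  p-p≡0 = +-inverseʳ

  *-distribˡ-- : ∀ k p q → k * (p - q) ≡ k * p - k * q
  *-distribˡ-- = solve 3 (λ k p q → k :* (p :- q) := k :* p :- k :* q) refl

  p-q≡0⇒p≡q : ∀ {p q} → p - q ≡ 0ℚ → p ≡ q
  p-q≡0⇒p≡q {p} {q} eq = trans (solve 2 (λ p q → p := (p :- q) :+ q) refl p q) (trans (cong (_+ q) eq) (+-identityˡ q))

  p+q≡0⇒p≡-q : ∀ {p q} → p + q ≡ 0ℚ → p ≡ - q
  p+q≡0⇒p≡-q {p} {q} eq = trans (solve 2 (λ p q → p := (p :+ q) :+ (:- q)) refl p q)
    (trans (cong (_+ - q) eq) (+-identityˡ (- q)))

  q≤p⇒0≤p-q : ∀ {p q} → q ≤ p → 0ℚ ≤ p - q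
  q≤p⇒0≤p-q {p} {q} q≤p = ≤-trans (≤-reflexive (sym (p-p≡0 q))) (+-monoˡ-≤ (- q) q≤p)

  q<p⇒0<p-q : ∀ {p q} → q < p → 0ℚ < p - q
  q<p⇒0<p-q {p} {q} q<p = <-≤-trans (≤-<-trans (≤-reflexive (sym (p-p≡0 q))) (+-monoˡ-< (- q) q<p)) ≤-refl

  p<q⇒p-q<0 : ∀ {p q} → p < q → p - q < 0ℚ
  p<q⇒p-q<0 {p} {q} p<q = <-≤-trans (+-monoˡ-< (- q) p<q) (≤-reflexive (p-p≡0 q))

  p*p≡∣p∣*∣p∣ : ∀ p → p * p ≡ ∣ p ∣ * ∣ p ∣
  p*p≡∣p∣*∣p∣ p with ∣p∣≡p∨∣p∣≡-p p
  ... | inj₁ eq = sym (cong₂ _*_ eq eq)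
  ... | inj₂ eq = trans (solve 1 (λ p → p :* p := (:- p) :* (:- p)) refl p) (sym (cong₂ _*_ eq eq))

  0≤p*p : ∀ p → 0ℚ ≤ p * p
  0≤p*p p = ≤-trans (*-≥0 (0≤∣p∣ p) (0≤∣p∣ p)) (≤-reflexive (sym (p*p≡∣p∣*∣p∣ p)))

  ∣p∣≤q⇒p*p≤q*q : ∀ {p q} → ∣ p ∣ ≤ q → p * p ≤ q * q
  ∣p∣≤q⇒p*p≤q*q {p} ∣p∣≤q = ≤-trans (≤-reflexive (p*p≡∣p∣*∣p∣ p))
    (≤-trans (*-monoʳ-≤-≥0 (0≤∣p∣ p) ∣p∣≤q) (*-monoˡ-≤-≥0 (≤-trans (0≤∣p∣ p) ∣p∣≤q) ∣p∣≤q))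

  1≤∣p∣⇒1≤p*p : ∀ {p} → 1ℚ ≤ ∣ p ∣ → 1ℚ ≤ p * p
  1≤∣p∣⇒1≤p*p {p} 1≤∣p∣ = ≤-trans (≤-reflexive (sym (*-identityʳ 1ℚ)))
    (≤-trans (*-monoʳ-≤-≥0 0≤1 1≤∣p∣) (≤-trans (*-monoˡ-≤-≥0 (0≤∣p∣ p) 1≤∣p∣) (≤-reflexive (sym (p*p≡∣p∣*∣p∣ p)))))

  ^-nonNeg : ∀ {x} r → 0ℚ ≤ x → 0ℚ ≤ x ^ r
  ^-nonNeg zero _ = 0≤1
  ^-nonNeg (suc r) 0≤x = *-≥0 0≤x (^-nonNeg r 0≤x)

  ^-pos : ∀ {x} r → 0ℚ < x → 0ℚ < x ^ r
  ^-pos zero _ = 0<1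
  ^-pos {x} (suc r) 0<x = ≤-<-trans (≤-reflexive (sym (*-zeroˡ (x ^ r))))
    (*-monoˡ-<-pos (x ^ r) {{positive (^-pos r 0<x)}} 0<x)

  ^-mono-≤ : ∀ r {x y} → 0ℚ ≤ x → x ≤ y → x ^ r ≤ y ^ r
  ^-mono-≤ zero _ _ = ≤-refl
  ^-mono-≤ (suc r) 0≤x x≤y =
    ≤-trans (*-monoʳ-≤-≥0 (^-nonNeg r 0≤x) x≤y) (*-monoˡ-≤-≥0 (≤-trans 0≤x x≤y) (^-mono-≤ r 0≤x x≤y))

  1^r≡1 : ∀ r → 1ℚ ^ r ≡ 1ℚ
  1^r≡1 zero = refl
  1^r≡1 (suc r) = trans (*-identityˡ _) (1^r≡1 r)

  ⟦⟧-homo-^ : ∀ b r → ⟦ b ℕ.^ r ⟧ ≡ ⟦ b ⟧ ^ r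
  ⟦⟧-homo-^ b zero = refl
  ⟦⟧-homo-^ b (suc r) = trans (⟦⟧-homo-* b (b ℕ.^ r)) (cong (⟦ b ⟧ *_) (⟦⟧-homo-^ b r))

  ∑< : ℕ → (ℕ → ℚ) → ℚ
  ∑< zero t = 0ℚ
  ∑< (suc m) t = ∑< m t + t m

  syntax ∑< m (λ i → t) = ∑[ i < m ] t

  ∑-cong : ∀ m {u v : ℕ → ℚ} → (∀ i → i ℕ.< m → u i ≡ v i) → ∑< m u ≡ ∑< m v
  ∑-cong zero eq = refl
  ∑-cong (suc m) eq = cong₂ _+_ (∑-cong m (λ i i<m → eq i (ℕ.m<n⇒m<1+n i<m))) (eq m ℕ.≤-refl)

  ∑-split-head : ∀ m (t : ℕ → ℚ) → ∑< (suc m) t ≡ t 0 + ∑[ i < m ] t (suc i)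
  ∑-split-head zero t = trans (+-identityˡ (t 0)) (sym (+-identityʳ (t 0)))
  ∑-split-head (suc m) t = trans (cong (_+ t (suc m)) (∑-split-head m t)) (+-assoc (t 0) _ _)

  ∑-distrib-+ : ∀ m (u v : ℕ → ℚ) → ∑[ i < m ] (u i + v i) ≡ ∑< m u + ∑< m v
  ∑-distrib-+ zero u v = sym (+-identityʳ 0ℚ)
  ∑-distrib-+ (suc m) u v = trans (cong (_+ (u m + v m)) (∑-distrib-+ m u v))
    (solve 4 (λ a b c d → (a :+ b) :+ (c :+ d) := (a :+ c) :+ (b :+ d)) refl (∑< m u) (∑< m v) (u m) (v m))

  ∑-distrib-- : ∀ m (u v : ℕ → ℚ) → ∑[ i < m ] (u i - v i) ≡ ∑< m u - ∑< m v
  ∑-distrib-- zero u v = sym (p-p≡0 0ℚ)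
  ∑-distrib-- (suc m) u v = trans (cong (_+ (u m - v m)) (∑-distrib-- m u v))
    (solve 4 (λ a b c d → (a :- b) :+ (c :- d) := (a :+ c) :- (b :+ d)) refl (∑< m u) (∑< m v) (u m) (v m))

  *-distribˡ-∑ : ∀ m c (u : ℕ → ℚ) → ∑[ i < m ] (c * u i) ≡ c * ∑< m u
  *-distribˡ-∑ zero c u = sym (*-zeroʳ c)
  *-distribˡ-∑ (suc m) c u = trans (cong (_+ (c * u m)) (*-distribˡ-∑ m c u)) (sym (*-distribˡ-+ c (∑< m u) (u m)))

  ∑-zero : ∀ m {u : ℕ → ℚ} → (∀ i → i ℕ.< m → u i ≡ 0ℚ) → ∑< m u ≡ 0ℚ
  ∑-zero m u≡0 = trans (∑-cong m u≡0) (zeros m)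
    where
    zeros : ∀ m → ∑[ i < m ] 0ℚ ≡ 0ℚ
    zeros zero = refl
    zeros (suc m) = cong (_+ 0ℚ) (zeros m)

  ∑-single : ∀ m j {u : ℕ → ℚ} → j ℕ.< m → (∀ i → i ℕ.< m → i ≢ j → u i ≡ 0ℚ) → ∑< m u ≡ u j
  ∑-single (suc m) j {u} j<1+m others with j ℕ.≟ m
  ... | yes refl = trans (cong (_+ u j) (∑-zero m (λ i i<j → others i (ℕ.m<n⇒m<1+n i<j) (ℕ.<⇒≢ i<j))))
                         (+-identityˡ (u j))
  ... | no j≢m = trans (cong₂ _+_ (∑-single m j (ℕ.≤∧≢⇒< (ℕ.≤-pred j<1+m) j≢m)
                                                 (λ i i<m → others i (ℕ.m<n⇒m<1+n i<m)))
                                  (others m ℕ.≤-refl (j≢m ∘ sym)))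
                       (+-identityʳ (u j))

module FiniteDifferences where

  open import Data.Empty using (⊥-elim)
  open import Data.Nat as ℕ using (ℕ; zero; suc; z≤n; s≤s)
  import Data.Nat.Properties as ℕ
  open import Data.Rational
  open import Data.Rational.Properties
  open import Data.Rational.Solver using (module +-*-Solver)
  open import Function using (_∘_)
  open import Relation.Binary.PropositionalEquality
  open import Relation.Nullary using (yes; no)
  open +-*-Solver using (solve; _:=_; _:+_; _:*_; _:-_; :-_; con)
  open RationalArithmetic

  Δ : ℚ → (ℚ → ℚ) → ℚ → ℚ
  Δ h f x = f (x + h) - f x

  -- Degree ≤ e in the sense that all (e+1)-fold finite differences vanish.
  Deg≤ : ℕ → (ℚ → ℚ) → Set
  Deg≤ zero f = ∀ x y → f x ≡ f y
  Deg≤ (suc e) f = ∀ h → Deg≤ e (Δ h f)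

  deg-cong : ∀ e {f g : ℚ → ℚ} → (∀ x → f x ≡ g x) → Deg≤ e f → Deg≤ e g
  deg-cong zero f≗g df x y = trans (sym (f≗g x)) (trans (df x y) (f≗g y))
  deg-cong (suc e) f≗g df h = deg-cong e (λ x → cong₂ _-_ (f≗g (x + h)) (f≗g x)) (df h)

  deg-const : ∀ e c → Deg≤ e (λ _ → c)
  deg-const zero c x y = refl
  deg-const (suc e) c h = deg-cong e (λ _ → sym (p-p≡0 c)) (deg-const e 0ℚ)

  deg-suc : ∀ e {f} → Deg≤ e f → Deg≤ (suc e) f
  deg-suc zero {f} df h = deg-cong zero (λ x → sym (trans (cong (_- f x) (df (x + h) x)) (p-p≡0 (f x)))) (deg-const zero 0ℚ)
  deg-suc (suc e) df h = deg-suc e (df h)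

  deg-mono : ∀ {a b f} → a ℕ.≤ b → Deg≤ a f → Deg≤ b f
  deg-mono {zero} {zero} z≤n df = df
  deg-mono {zero} {suc b} z≤n df = deg-suc b (deg-mono {zero} {b} z≤n df)
  deg-mono (s≤s a≤b) df h = deg-mono a≤b (df h)

  deg-+ : ∀ e {f g} → Deg≤ e f → Deg≤ e g → Deg≤ e (λ x → f x + g x)
  deg-+ zero df dg x y = cong₂ _+_ (df x y) (dg x y)
  deg-+ (suc e) {f} {g} df dg h = deg-cong e
    (λ x → solve 4 (λ a b c d → (a :- b) :+ (c :- d) := (a :+ c) :- (b :+ d)) refl (f (x + h)) (f x) (g (x + h)) (g x))
    (deg-+ e (df h) (dg h))

  deg-scale : ∀ e c {f} → Deg≤ e f → Deg≤ e (λ x → c * f x)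
  deg-scale zero c df x y = cong (c *_) (df x y)
  deg-scale (suc e) c {f} df h = deg-cong e
    (λ x → solve 3 (λ c a b → c :* (a :- b) := c :* a :- c :* b) refl c (f (x + h)) (f x))
    (deg-scale e c (df h))

  deg-- : ∀ e {f g} → Deg≤ e f → Deg≤ e g → Deg≤ e (λ x → f x - g x)
  deg-- e {f} {g} df dg = deg-cong e (λ x → solve 2 (λ a b → a :+ con (- 1ℚ) :* b := a :- b) refl (f x) (g x))
    (deg-+ e df (deg-scale e (- 1ℚ) dg))

  deg-shift : ∀ e a {f} → Deg≤ e f → Deg≤ e (λ x → f (x + a))
  deg-shift zero a df x y = df (x + a) (y + a)
  deg-shift (suc e) a {f} df h = deg-cong e
    (λ x → cong (λ z → f z - f (x + a)) (solve 3 (λ x a h → x :+ a :+ h := x :+ h :+ a) refl x a h))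
    (deg-shift e a (df h))

  deg-id : Deg≤ 1 (λ x → x)
  deg-id h x y = trans (x+h-x x) (sym (x+h-x y))
    where
    x+h-x : ∀ x → x + h - x ≡ h
    x+h-x x = solve 2 (λ x h → x :+ h :- x := h) refl x h

  deg-* : ∀ a b {f g} → Deg≤ a f → Deg≤ b g → Deg≤ (a ℕ.+ b) (λ x → f x * g x)
  deg-* zero b {f} {g} df dg = deg-cong b (λ x → cong (_* g x) (df 0ℚ x)) (deg-scale b (f 0ℚ) dg)
  deg-* (suc a) zero {f} {g} df dg = subst (λ k → Deg≤ k (λ x → f x * g x)) (sym (ℕ.+-identityʳ (suc a)))
    (deg-cong (suc a) (λ x → trans (*-comm (g 0ℚ) (f x)) (cong (f x *_) (dg 0ℚ x))) (deg-scale (suc a) (g 0ℚ) df))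
  deg-* (suc a) (suc b) {f} {g} df dg h = deg-cong (a ℕ.+ suc b)
    (λ x → solve 4 (λ p q r s → (p :- q) :* r :+ q :* (r :- s) := p :* r :- q :* s) refl (f (x + h)) (f x) (g (x + h)) (g x))
    (deg-+ (a ℕ.+ suc b) (deg-* a (suc b) {Δ h f} {λ x → g (x + h)} (df h) (deg-shift (suc b) h {g} dg))
       (subst (λ k → Deg≤ k (λ x → f x * Δ h g x)) (sym (ℕ.+-suc a b)) (deg-* (suc a) b {f} {Δ h g} df (dg h))))

  deg-^ : ∀ r e {f} → Deg≤ e f → Deg≤ (r ℕ.* e) (λ x → f x ^ r)
  deg-^ zero e df = deg-const zero 1ℚ
  deg-^ (suc r) e df = deg-* e (r ℕ.* e) df (deg-^ r e df)

  deg-∑ : ∀ e m (t : ℕ → ℚ → ℚ) → (∀ j → j ℕ.< m → Deg≤ e (t j)) → Deg≤ e (λ x → ∑[ j < m ] t j x)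
  deg-∑ e zero t dt = deg-const e 0ℚ
  deg-∑ e (suc m) t dt = deg-+ e (deg-∑ e m t (λ j j<m → dt j (ℕ.m<n⇒m<1+n j<m))) (dt m ℕ.≤-refl)

  Δ^ : ℕ → (ℚ → ℚ) → ℚ → ℚ
  Δ^ zero f = f
  Δ^ (suc m) f = Δ^ m (Δ 1ℚ f)

  Δ^-vanish : ∀ m e {f} → Deg≤ e f → e ℕ.< m → ∀ x → Δ^ m f x ≡ 0ℚ
  Δ^-vanish (suc zero) zero {f} df _ x = trans (cong (_- f x) (df (x + 1ℚ) x)) (p-p≡0 (f x))
  Δ^-vanish (suc (suc m)) zero df _ = Δ^-vanish (suc m) zero (deg-suc zero df 1ℚ) (s≤s z≤n)
  Δ^-vanish (suc m) (suc e) df (s≤s e<m) = Δ^-vanish m e (df 1ℚ) e<m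

  ∇ : (ℕ → ℚ) → ℕ → ℚ
  ∇ c zero = - c zero
  ∇ c (suc i) = c i - c (suc i)

  ∑-by-parts : ∀ k (c a : ℕ → ℚ) → ∑[ i < suc k ] (∇ c i * a i) ≡ ∑[ i < k ] (c i * (a (suc i) - a i)) - c k * a k
  ∑-by-parts zero c a = solve 2 (λ c a → con 0ℚ :+ (:- c) :* a := con 0ℚ :- c :* a) refl (c 0) (a 0)
  ∑-by-parts (suc k) c a = trans (cong (_+ ∇ c (suc k) * a (suc k)) (∑-by-parts k c a))
    (solve 5 (λ S c c′ a a′ → S :- c :* a :+ (c :- c′) :* a′ := S :+ c :* (a′ :- a) :- c′ :* a′) refl
       (∑[ i < k ] (c i * (a (suc i) - a i))) (c k) (c (suc k)) (a k) (a (suc k)))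

  -- altBinomial m i = (-1)^(m-i) · (m choose i), the coefficients of Δ^ m.
  altBinomial : ℕ → ℕ → ℚ
  altBinomial zero zero = 1ℚ
  altBinomial zero (suc i) = 0ℚ
  altBinomial (suc m) = ∇ (altBinomial m)

  altBinomial-out : ∀ m i → m ℕ.< i → altBinomial m i ≡ 0ℚ
  altBinomial-out zero (suc i) _ = refl
  altBinomial-out (suc m) (suc i) (s≤s m<i) =
    trans (cong₂ _-_ (altBinomial-out m i m<i) (altBinomial-out m (suc i) (ℕ.m<n⇒m<1+n m<i))) (p-p≡0 0ℚ)

  x+i+1≡x+[1+i] : ∀ x i → x + ⟦ i ⟧ + 1ℚ ≡ x + ⟦ suc i ⟧
  x+i+1≡x+[1+i] x i = solve 2 (λ x i → x :+ i :+ con 1ℚ := x :+ (con 1ℚ :+ i)) refl x ⟦ i ⟧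

  Δ^-expansion : ∀ m f x → Δ^ m f x ≡ ∑[ i < suc m ] (altBinomial m i * f (x + ⟦ i ⟧))
  Δ^-expansion zero f x = sym (trans (+-identityˡ _) (trans (*-identityˡ _) (cong f (+-identityʳ x))))
  Δ^-expansion (suc m) f x = begin
      Δ^ m (Δ 1ℚ f) x
    ≡⟨ Δ^-expansion m (Δ 1ℚ f) x ⟩
      ∑[ i < suc m ] (altBinomial m i * (f (x + ⟦ i ⟧ + 1ℚ) - a i))
    ≡⟨ ∑-cong (suc m) (λ i _ → cong (λ y → altBinomial m i * (f y - a i)) (x+i+1≡x+[1+i] x i)) ⟩
      ∑[ i < suc m ] (altBinomial m i * (a (suc i) - a i))
    ≡⟨ sym (trans (cong (λ z → S - z * a (suc m)) (altBinomial-out m (suc m) ℕ.≤-refl))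
                  (solve 2 (λ S a → S :- con 0ℚ :* a := S) refl S (a (suc m)))) ⟩
      S - altBinomial m (suc m) * a (suc m)
    ≡⟨ sym (∑-by-parts (suc m) (altBinomial m) a) ⟩
      ∑[ i < suc (suc m) ] (altBinomial (suc m) i * a i)
    ∎
    where
    open ≡-Reasoning
    a : ℕ → ℚ
    a i = f (x + ⟦ i ⟧)
    S = ∑[ i < suc m ] (altBinomial m i * (a (suc i) - a i))

  Δ^-linear : ∀ m c f g x → Δ^ m (λ y → c * f y + g y) x ≡ c * Δ^ m f x + Δ^ m g x
  Δ^-linear m c f g x = begin
      Δ^ m (λ y → c * f y + g y) x
    ≡⟨ Δ^-expansion m _ x ⟩
      ∑[ i < suc m ] (altBinomial m i * (c * f (x + ⟦ i ⟧) + g (x + ⟦ i ⟧)))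
    ≡⟨ ∑-cong (suc m) (λ i _ → solve 4 (λ s c f g → s :* (c :* f :+ g) := c :* (s :* f) :+ s :* g) refl
                                  (altBinomial m i) c (f (x + ⟦ i ⟧)) (g (x + ⟦ i ⟧))) ⟩
      ∑[ i < suc m ] (c * (altBinomial m i * f (x + ⟦ i ⟧)) + altBinomial m i * g (x + ⟦ i ⟧))
    ≡⟨ ∑-distrib-+ (suc m) _ _ ⟩
      ∑[ i < suc m ] (c * (altBinomial m i * f (x + ⟦ i ⟧))) + ∑[ i < suc m ] (altBinomial m i * g (x + ⟦ i ⟧))
    ≡⟨ cong₂ _+_ (trans (*-distribˡ-∑ (suc m) c _) (cong (c *_) (sym (Δ^-expansion m f x)))) (sym (Δ^-expansion m g x)) ⟩
      c * Δ^ m f x + Δ^ m g x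
    ∎
    where open ≡-Reasoning

  Δ^-bound : ∀ m f x ε → (∀ i → i ℕ.≤ m → ∣ f (x + ⟦ i ⟧) ∣ ≤ ε) → ∣ Δ^ m f x ∣ ≤ ⟦ 2 ⟧ ^ m * ε
  Δ^-bound zero f x ε bound = ≤-trans (≤-reflexive (cong (∣_∣ ∘ f) (sym (+-identityʳ x))))
                                      (≤-trans (bound 0 z≤n) (≤-reflexive (sym (*-identityˡ ε))))
  Δ^-bound (suc m) f x ε bound = ≤-trans (Δ^-bound m (Δ 1ℚ f) x (ε + ε) Δbound)
    (≤-reflexive (solve 2 (λ p e → p :* (e :+ e) := (con 1ℚ :+ (con 1ℚ :+ con 0ℚ)) :* p :* e) refl (⟦ 2 ⟧ ^ m) ε))
    where
    Δbound : ∀ i → i ℕ.≤ m → ∣ f (x + ⟦ i ⟧ + 1ℚ) - f (x + ⟦ i ⟧) ∣ ≤ ε + ε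
    Δbound i i≤m = ≤-trans (∣p-q∣≤∣p∣+∣q∣ (f (x + ⟦ i ⟧ + 1ℚ)) (f (x + ⟦ i ⟧)))
      (+-mono-≤ (≤-trans (≤-reflexive (cong (∣_∣ ∘ f) (x+i+1≡x+[1+i] x i)))
                         (bound (suc i) (s≤s i≤m)))
                (bound i (ℕ.m≤n⇒m≤1+n i≤m)))

  altBinomial-ratio : ∀ m i → ⟦ suc i ⟧ * altBinomial m (suc i) ≡ (⟦ i ⟧ - ⟦ m ⟧) * altBinomial m i
  altBinomial-ratio zero zero = refl
  altBinomial-ratio zero (suc i) = trans (*-zeroʳ ⟦ suc (suc i) ⟧) (sym (*-zeroʳ (⟦ suc i ⟧ - 0ℚ)))
  altBinomial-ratio (suc m) zero = begin
      ⟦ 1 ⟧ * (a - b)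
    ≡⟨ *-distribˡ-- ⟦ 1 ⟧ a b ⟩
      ⟦ 1 ⟧ * a - ⟦ 1 ⟧ * b
    ≡⟨ cong (λ z → ⟦ 1 ⟧ * a - z) (altBinomial-ratio m 0) ⟩
      ⟦ 1 ⟧ * a - (0ℚ - ⟦ m ⟧) * a
    ≡⟨ solve 2 (λ a m → (con 1ℚ :+ con 0ℚ) :* a :- (con 0ℚ :- m) :* a := (con 0ℚ :- (con 1ℚ :+ m)) :* (:- a))
               refl a ⟦ m ⟧ ⟩
      (0ℚ - ⟦ suc m ⟧) * (- a)
    ∎
    where
    open ≡-Reasoning
    a = altBinomial m 0
    b = altBinomial m 1
  altBinomial-ratio (suc m) (suc i) = begin
      ⟦ suc (suc i) ⟧ * (b - c)
    ≡⟨ *-distribˡ-- ⟦ suc (suc i) ⟧ b c ⟩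
      ⟦ suc (suc i) ⟧ * b - ⟦ suc (suc i) ⟧ * c
    ≡⟨ cong (λ z → ⟦ suc (suc i) ⟧ * b - z) (altBinomial-ratio m (suc i)) ⟩
      ⟦ suc (suc i) ⟧ * b - (⟦ suc i ⟧ - ⟦ m ⟧) * b
    ≡⟨ solve 3 (λ i m b → (con 1ℚ :+ (con 1ℚ :+ i)) :* b :- ((con 1ℚ :+ i) :- m) :* b
                          := (con 1ℚ :+ i) :* b :- (i :- m) :* b) refl ⟦ i ⟧ ⟦ m ⟧ b ⟩
      ⟦ suc i ⟧ * b - (⟦ i ⟧ - ⟦ m ⟧) * b
    ≡⟨ cong (λ z → z - (⟦ i ⟧ - ⟦ m ⟧) * b) (altBinomial-ratio m i) ⟩
      (⟦ i ⟧ - ⟦ m ⟧) * a - (⟦ i ⟧ - ⟦ m ⟧) * b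
    ≡⟨ solve 4 (λ i m a b → (i :- m) :* a :- (i :- m) :* b := ((con 1ℚ :+ i) :- (con 1ℚ :+ m)) :* (a :- b)) refl
         ⟦ i ⟧ ⟦ m ⟧ a b ⟩
      (⟦ suc i ⟧ - ⟦ suc m ⟧) * (a - b)
    ∎
    where
    open ≡-Reasoning
    a = altBinomial m i
    b = altBinomial m (suc i)
    c = altBinomial m (suc (suc i))

  altBinomial-pascal-ratio : ∀ m i → ⟦ suc i ⟧ * altBinomial (suc m) (suc i) ≡ ⟦ suc m ⟧ * altBinomial m i
  altBinomial-pascal-ratio m i = begin
      ⟦ suc i ⟧ * (a - b)
    ≡⟨ *-distribˡ-- ⟦ suc i ⟧ a b ⟩
      ⟦ suc i ⟧ * a - ⟦ suc i ⟧ * b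
    ≡⟨ cong (λ z → ⟦ suc i ⟧ * a - z) (altBinomial-ratio m i) ⟩
      ⟦ suc i ⟧ * a - (⟦ i ⟧ - ⟦ m ⟧) * a
    ≡⟨ solve 3 (λ i m a → (con 1ℚ :+ i) :* a :- (i :- m) :* a := (con 1ℚ :+ m) :* a) refl ⟦ i ⟧ ⟦ m ⟧ a ⟩
      ⟦ suc m ⟧ * a
    ∎
    where
    open ≡-Reasoning
    a = altBinomial m i
    b = altBinomial m (suc i)

  central : ℕ → ℚ
  central N = altBinomial (N ℕ.+ N) N

  ⟦1+2N⟧ : ∀ N → ⟦ suc (N ℕ.+ N) ⟧ ≡ 1ℚ + (⟦ N ⟧ + ⟦ N ⟧)
  ⟦1+2N⟧ N = cong (1ℚ +_) (⟦⟧-homo-+ N N)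

  central-step : ∀ N → ⟦ suc N ⟧ * central (suc N) ≡ - (⟦ 2 ⟧ * ⟦ suc (N ℕ.+ N) ⟧) * central N
  central-step N = *-cancelˡ->0 (⟦suc⟧-pos N) (begin
      K * (K * central (suc N))
    ≡⟨ cong (λ k → K * (K * altBinomial (suc k) (suc N))) (ℕ.+-suc N N) ⟩
      K * (K * altBinomial (suc (suc (N ℕ.+ N))) (suc N))
    ≡⟨ cong (K *_) (altBinomial-pascal-ratio (suc (N ℕ.+ N)) N) ⟩
      K * ((1ℚ + M) * Y)
    ≡⟨ cong (λ m → K * ((1ℚ + m) * Y)) (⟦1+2N⟧ N) ⟩
      K * ((1ℚ + (1ℚ + (n + n))) * Y)
    ≡⟨ solve 2 (λ n Y → (con 1ℚ :+ n) :* ((con 1ℚ :+ (con 1ℚ :+ (n :+ n))) :* Y)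
                        := :- (con ⟦ 2 ⟧ :* (con 1ℚ :+ n)) :* ((n :- (con 1ℚ :+ (n :+ n))) :* Y)) refl n Y ⟩
      - (⟦ 2 ⟧ * K) * ((n - (1ℚ + (n + n))) * Y)
    ≡⟨ cong (λ m → - (⟦ 2 ⟧ * K) * ((n - m) * Y)) (sym (⟦1+2N⟧ N)) ⟩
      - (⟦ 2 ⟧ * K) * ((n - M) * Y)
    ≡⟨ cong (- (⟦ 2 ⟧ * K) *_) (trans (sym (altBinomial-ratio (suc (N ℕ.+ N)) N))
                                       (altBinomial-pascal-ratio (N ℕ.+ N) N)) ⟩
      - (⟦ 2 ⟧ * K) * (M * central N)
    ≡⟨ solve 4 (λ t k m c → :- (t :* k) :* (m :* c) := k :* (:- (t :* m) :* c)) refl ⟦ 2 ⟧ K M (central N) ⟩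
      K * (- (⟦ 2 ⟧ * M) * central N)
    ∎)
    where
    open ≡-Reasoning
    n = ⟦ N ⟧
    K = ⟦ suc N ⟧
    M = ⟦ suc (N ℕ.+ N) ⟧
    Y = altBinomial (suc (N ℕ.+ N)) N

  central-abs-step : ∀ N → ⟦ suc N ⟧ * ∣ central (suc N) ∣ ≡ ⟦ 2 ⟧ * ⟦ suc (N ℕ.+ N) ⟧ * ∣ central N ∣
  central-abs-step N = begin
      ⟦ suc N ⟧ * ∣ central (suc N) ∣
    ≡⟨ cong (_* ∣ central (suc N) ∣) (sym (0≤p⇒∣p∣≡p (⟦⟧-nonNeg (suc N)))) ⟩
      ∣ ⟦ suc N ⟧ ∣ * ∣ central (suc N) ∣
    ≡⟨ sym (∣p*q∣≡∣p∣*∣q∣ ⟦ suc N ⟧ (central (suc N))) ⟩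
      ∣ ⟦ suc N ⟧ * central (suc N) ∣
    ≡⟨ cong ∣_∣ (central-step N) ⟩
      ∣ - (⟦ 2 ⟧ * ⟦ suc (N ℕ.+ N) ⟧) * central N ∣
    ≡⟨ ∣p*q∣≡∣p∣*∣q∣ (- (⟦ 2 ⟧ * ⟦ suc (N ℕ.+ N) ⟧)) (central N) ⟩
      ∣ - (⟦ 2 ⟧ * ⟦ suc (N ℕ.+ N) ⟧) ∣ * ∣ central N ∣
    ≡⟨ cong (_* ∣ central N ∣)
         (trans (∣-p∣≡∣p∣ _) (0≤p⇒∣p∣≡p (*-≥0 (⟦⟧-nonNeg 2) (⟦⟧-nonNeg (suc (N ℕ.+ N)))))) ⟩
      ⟦ 2 ⟧ * ⟦ suc (N ℕ.+ N) ⟧ * ∣ central N ∣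
    ∎
    where open ≡-Reasoning

  central-lower-bound : ∀ N → ⟦ 2 ⟧ ^ (N ℕ.+ N) ≤ ∣ central N ∣ * ⟦ suc (N ℕ.+ N) ⟧
  central-lower-bound zero = ≤-refl
  central-lower-bound (suc N) = *-cancelˡ-≤->0 (⟦suc⟧-pos N) (begin
      K * ⟦ 2 ⟧ ^ (suc N ℕ.+ suc N)
    ≡⟨ cong (λ k → K * ⟦ 2 ⟧ ^ suc k) (ℕ.+-suc N N) ⟩
      K * (⟦ 2 ⟧ * (⟦ 2 ⟧ * ⟦ 2 ⟧ ^ (N ℕ.+ N)))
    ≡⟨ solve 3 (λ k t p → k :* (t :* (t :* p)) := (t :* t :* k) :* p) refl K ⟦ 2 ⟧ (⟦ 2 ⟧ ^ (N ℕ.+ N)) ⟩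
      ⟦ 4 ⟧ * K * ⟦ 2 ⟧ ^ (N ℕ.+ N)
    ≤⟨ *-monoˡ-≤-≥0 (*-≥0 (⟦⟧-nonNeg 4) (⟦⟧-nonNeg (suc N))) (central-lower-bound N) ⟩
      ⟦ 4 ⟧ * K * (A * M)
    ≤⟨ p≤p+q (*-≥0 (⟦⟧-nonNeg 2) (*-≥0 (0≤∣p∣ (central N)) (⟦⟧-nonNeg (suc (N ℕ.+ N))))) ⟩
      ⟦ 4 ⟧ * K * (A * M) + ⟦ 2 ⟧ * (A * M)
    ≡⟨ cong (λ m → ⟦ 4 ⟧ * K * (A * m) + ⟦ 2 ⟧ * (A * m)) (⟦1+2N⟧ N) ⟩
      ⟦ 4 ⟧ * K * (A * (1ℚ + (n + n))) + ⟦ 2 ⟧ * (A * (1ℚ + (n + n)))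
    ≡⟨ solve 2 (λ n a → con ⟦ 4 ⟧ :* (con 1ℚ :+ n) :* (a :* (con 1ℚ :+ (n :+ n)))
                          :+ con ⟦ 2 ⟧ :* (a :* (con 1ℚ :+ (n :+ n)))
                        := con ⟦ 2 ⟧ :* (con 1ℚ :+ (n :+ n)) :* a :* (con 1ℚ :+ ((con 1ℚ :+ n) :+ (con 1ℚ :+ n))))
               refl n A ⟩
      ⟦ 2 ⟧ * (1ℚ + (n + n)) * A * (1ℚ + (K + K))
    ≡⟨ cong₂ (λ m m′ → ⟦ 2 ⟧ * m * A * m′) (sym (⟦1+2N⟧ N)) (sym (⟦1+2N⟧ (suc N))) ⟩
      ⟦ 2 ⟧ * M * A * ⟦ suc (suc N ℕ.+ suc N) ⟧
    ≡⟨ cong (_* ⟦ suc (suc N ℕ.+ suc N) ⟧) (sym (central-abs-step N)) ⟩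
      K * ∣ central (suc N) ∣ * ⟦ suc (suc N ℕ.+ suc N) ⟧
    ≡⟨ *-assoc K _ _ ⟩
      K * (∣ central (suc N) ∣ * ⟦ suc (suc N ℕ.+ suc N) ⟧)
    ∎)
    where
    open ≤-Reasoning
    n = ⟦ N ⟧
    K = ⟦ suc N ⟧
    M = ⟦ suc (N ℕ.+ N) ⟧
    A = ∣ central N ∣

  Δ^-cong : ∀ m {f g} → (∀ x → f x ≡ g x) → ∀ x → Δ^ m f x ≡ Δ^ m g x
  Δ^-cong zero f≗g = f≗g
  Δ^-cong (suc m) f≗g = Δ^-cong m (λ x → cong₂ _-_ (f≗g (x + 1ℚ)) (f≗g x))

  δ₀ : ℚ → ℚ
  δ₀ y with y ≟ 0ℚ
  ... | yes _ = 1ℚ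
  ... | no _ = 0ℚ

  δ₀-nonzero : ∀ {y} → y ≢ 0ℚ → δ₀ y ≡ 0ℚ
  δ₀-nonzero {y} y≢0 with y ≟ 0ℚ
  ... | yes y≡0 = ⊥-elim (y≢0 y≡0)
  ... | no _ = refl

  -N+N≡0 : ∀ N → - ⟦ N ⟧ + ⟦ N ⟧ ≡ 0ℚ
  -N+N≡0 N = +-inverseˡ ⟦ N ⟧

  -N+i≢0 : ∀ N i → i ≢ N → - ⟦ N ⟧ + ⟦ i ⟧ ≢ 0ℚ
  -N+i≢0 N i i≢N eq = i≢N (⟦⟧-injective (p-q≡0⇒p≡q (trans (+-comm ⟦ i ⟧ (- ⟦ N ⟧)) eq)))

  Δ^-δ₀ : ∀ N → Δ^ (N ℕ.+ N) δ₀ (- ⟦ N ⟧) ≡ central N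
  Δ^-δ₀ N = begin
      Δ^ (N ℕ.+ N) δ₀ (- ⟦ N ⟧)
    ≡⟨ Δ^-expansion (N ℕ.+ N) δ₀ (- ⟦ N ⟧) ⟩
      ∑[ i < suc (N ℕ.+ N) ] (altBinomial (N ℕ.+ N) i * δ₀ (- ⟦ N ⟧ + ⟦ i ⟧))
    ≡⟨ ∑-single (suc (N ℕ.+ N)) N (s≤s (ℕ.m≤m+n N N))
         (λ i _ i≢N → trans (cong (altBinomial (N ℕ.+ N) i *_) (δ₀-nonzero (-N+i≢0 N i i≢N)))
                             (*-zeroʳ (altBinomial (N ℕ.+ N) i))) ⟩
      altBinomial (N ℕ.+ N) N * δ₀ (- ⟦ N ⟧ + ⟦ N ⟧)
    ≡⟨ cong (λ y → central N * δ₀ y) (-N+N≡0 N) ⟩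
      central N * 1ℚ
    ≡⟨ *-identityʳ (central N) ⟩
      central N
    ∎
    where open ≡-Reasoning

  -- Δ^ (N+N) H (-N) = 0, and its central term H 0 · central N is bounded by the remaining ones.
  central-coefficient-bound : ∀ N e H → Deg≤ e H → e ℕ.< N ℕ.+ N → ∀ ε → 0ℚ ≤ ε →
    (∀ i → i ℕ.≤ N ℕ.+ N → i ≢ N → ∣ H (- ⟦ N ⟧ + ⟦ i ⟧) ∣ ≤ ε) → ∣ H 0ℚ * central N ∣ ≤ ⟦ 2 ⟧ ^ (N ℕ.+ N) * ε
  central-coefficient-bound N e H dH e<2N ε 0≤ε bound = begin
      ∣ H 0ℚ * central N ∣
    ≡⟨ cong ∣_∣ (p+q≡0⇒p≡-q (sym split)) ⟩
      ∣ - Δ^ (N ℕ.+ N) E x ∣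
    ≡⟨ ∣-p∣≡∣p∣ _ ⟩
      ∣ Δ^ (N ℕ.+ N) E x ∣
    ≤⟨ Δ^-bound (N ℕ.+ N) E x ε E-bound ⟩
      ⟦ 2 ⟧ ^ (N ℕ.+ N) * ε
    ∎
    where
    open ≤-Reasoning
    x = - ⟦ N ⟧
    E : ℚ → ℚ
    E y = H y - H 0ℚ * δ₀ y
    split : 0ℚ ≡ H 0ℚ * central N + Δ^ (N ℕ.+ N) E x
    split = trans (sym (Δ^-vanish (N ℕ.+ N) e dH e<2N x))
      (trans (Δ^-cong (N ℕ.+ N) (λ y → solve 3 (λ h a d → h := a :* d :+ (h :- a :* d)) refl (H y) (H 0ℚ) (δ₀ y)) x)
        (trans (Δ^-linear (N ℕ.+ N) (H 0ℚ) δ₀ E x) (cong (λ c → H 0ℚ * c + Δ^ (N ℕ.+ N) E x) (Δ^-δ₀ N))))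
    E-bound : ∀ i → i ℕ.≤ N ℕ.+ N → ∣ E (x + ⟦ i ⟧) ∣ ≤ ε
    E-bound i i≤2N with i ℕ.≟ N
    ... | yes refl = ≤-trans (≤-reflexive (cong ∣_∣ (trans (cong E (-N+N≡0 N))
                       (trans (cong (λ z → H 0ℚ - z) (*-identityʳ (H 0ℚ))) (p-p≡0 (H 0ℚ)))))) 0≤ε
    ... | no i≢N = ≤-trans (≤-reflexive (cong ∣_∣ (trans (cong (λ z → H (x + ⟦ i ⟧) - H 0ℚ * z) (δ₀-nonzero (-N+i≢0 N i i≢N)))
                       (trans (cong (λ z → H (x + ⟦ i ⟧) - z) (*-zeroʳ (H 0ℚ))) (+-identityʳ _)))))
                     (bound i i≤2N i≢N)

  extrapolation : ∀ N e H → Deg≤ e H → e ℕ.< N ℕ.+ N → ∀ ε → 0ℚ ≤ ε →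
    (∀ i → i ℕ.≤ N ℕ.+ N → i ≢ N → ∣ H (- ⟦ N ⟧ + ⟦ i ⟧) ∣ ≤ ε) → 1ℚ ≤ H 0ℚ → 1ℚ ≤ ⟦ suc (N ℕ.+ N) ⟧ * ε
  extrapolation N e H dH e<2N ε 0≤ε bound 1≤H0 = *-cancelˡ-≤->0 (^-pos (N ℕ.+ N) (⟦suc⟧-pos 1)) (begin
      ⟦ 2 ⟧ ^ (N ℕ.+ N) * 1ℚ
    ≡⟨ *-identityʳ _ ⟩
      ⟦ 2 ⟧ ^ (N ℕ.+ N)
    ≤⟨ central-lower-bound N ⟩
      ∣ central N ∣ * ⟦ suc (N ℕ.+ N) ⟧
    ≤⟨ *-monoʳ-≤-≥0 (⟦⟧-nonNeg (suc (N ℕ.+ N))) ∣c∣≤∣H0*c∣ ⟩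
      ∣ H 0ℚ * central N ∣ * ⟦ suc (N ℕ.+ N) ⟧
    ≤⟨ *-monoʳ-≤-≥0 (⟦⟧-nonNeg (suc (N ℕ.+ N))) (central-coefficient-bound N e H dH e<2N ε 0≤ε bound) ⟩
      ⟦ 2 ⟧ ^ (N ℕ.+ N) * ε * ⟦ suc (N ℕ.+ N) ⟧
    ≡⟨ solve 3 (λ p e k → p :* e :* k := p :* (k :* e)) refl (⟦ 2 ⟧ ^ (N ℕ.+ N)) ε ⟦ suc (N ℕ.+ N) ⟧ ⟩
      ⟦ 2 ⟧ ^ (N ℕ.+ N) * (⟦ suc (N ℕ.+ N) ⟧ * ε)
    ∎)
    where
    open ≤-Reasoning
    ∣c∣≤∣H0*c∣ : ∣ central N ∣ ≤ ∣ H 0ℚ * central N ∣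
    ∣c∣≤∣H0*c∣ = ≤-trans (≤-reflexive (sym (*-identityˡ _)))
      (≤-trans (*-monoʳ-≤-≥0 (0≤∣p∣ (central N)) (≤-trans 1≤H0 (≤-reflexive (sym (0≤p⇒∣p∣≡p (≤-trans 0≤1 1≤H0))))))
               (≤-reflexive (sym (∣p*q∣≡∣p∣*∣q∣ (H 0ℚ) (central N)))))

module FallingFactorials where

  open import Data.Empty using (⊥-elim)
  open import Data.Nat as ℕ using (ℕ; zero; suc)
  import Data.Nat.Properties as ℕ
  open import Data.Product using (∃; _×_; _,_)
  open import Data.Rational
  open import Data.Rational.Properties
  open import Data.Rational.Solver using (module +-*-Solver)
  open import Relation.Binary.Definitions using (tri<; tri≈; tri>)
  open import Relation.Binary.PropositionalEquality
  open +-*-Solver using (solve; _:=_; _:+_; _:*_; _:-_; :-_; con)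
  open RationalArithmetic
  open FiniteDifferences

  falling : ℚ → ℕ → ℚ
  falling y zero = 1ℚ
  falling y (suc j) = y * falling (y - 1ℚ) j

  falling-suc : ∀ y j → falling y (suc j) ≡ falling y j * (y - ⟦ j ⟧)
  falling-suc y zero = solve 1 (λ y → y :* con 1ℚ := con 1ℚ :* (y :- con 0ℚ)) refl y
  falling-suc y (suc j) = begin
      y * falling (y - 1ℚ) (suc j)
    ≡⟨ cong (y *_) (falling-suc (y - 1ℚ) j) ⟩
      y * (falling (y - 1ℚ) j * (y - 1ℚ - ⟦ j ⟧))
    ≡⟨ solve 3 (λ y f j → y :* (f :* (y :- con 1ℚ :- j)) := y :* f :* (y :- (con 1ℚ :+ j))) refl y (falling (y - 1ℚ) j) ⟦ j ⟧ ⟩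
      y * falling (y - 1ℚ) j * (y - ⟦ suc j ⟧)
    ∎
    where open ≡-Reasoning

  falling-Δ : ∀ y j → y * (falling y j - falling (y - 1ℚ) j) ≡ ⟦ j ⟧ * falling y j
  falling-Δ y j = begin
      y * (falling y j - falling (y - 1ℚ) j)
    ≡⟨ *-distribˡ-- y (falling y j) (falling (y - 1ℚ) j) ⟩
      y * falling y j - falling y (suc j)
    ≡⟨ cong (λ z → y * falling y j - z) (falling-suc y j) ⟩
      y * falling y j - falling y j * (y - ⟦ j ⟧)
    ≡⟨ solve 3 (λ y f j → y :* f :- f :* (y :- j) := j :* f) refl y (falling y j) ⟦ j ⟧ ⟩
      ⟦ j ⟧ * falling y j
    ∎
    where open ≡-Reasoning

  record FallingExpansion (D : ℕ) (G : ℚ → ℚ) : Set where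
    constructor _,_
    field
      coefficient : ℕ → ℚ
      expands : ∀ y → G y ≡ ∑[ j < suc D ] (coefficient j * falling y j)

  expansion-cong : ∀ {D G H} → (∀ y → G y ≡ H y) → FallingExpansion D G → FallingExpansion D H
  expansion-cong G≗H (c , expand) = c , λ y → trans (sym (G≗H y)) (expand y)

  expansion-const : ∀ D c → FallingExpansion D (λ _ → c)
  expansion-const D c = coeff , λ y → sym (trans (∑-split-head D (λ j → coeff j * falling y j))
      (trans (cong₂ _+_ (*-identityʳ c) (∑-zero D (λ j _ → *-zeroˡ (falling y (suc j))))) (+-identityʳ c)))
    where
    coeff : ℕ → ℚ
    coeff zero = c
    coeff (suc j) = 0ℚ

  expansion-+ : ∀ {D G H} → FallingExpansion D G → FallingExpansion D H → FallingExpansion D (λ y → G y + H y)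
  expansion-+ {D} (a , expandG) (b , expandH) = (λ j → a j + b j) , λ y → trans (cong₂ _+_ (expandG y) (expandH y))
    (sym (trans (∑-cong (suc D) (λ j _ → *-distribʳ-+ (falling y j) (a j) (b j))) (∑-distrib-+ (suc D) _ _)))

  expansion-scale : ∀ {D G} c → FallingExpansion D G → FallingExpansion D (λ y → c * G y)
  expansion-scale {D} c (a , expand) = (λ j → c * a j) , λ y → trans (cong (c *_) (expand y))
    (sym (trans (∑-cong (suc D) (λ j _ → *-assoc c (a j) (falling y j))) (*-distribˡ-∑ (suc D) c _)))

  expansion-yΔ : ∀ {D G} → FallingExpansion D G → FallingExpansion D (λ y → y * (G y - G (y - 1ℚ)))
  expansion-yΔ {D} {G} (a , expand) = (λ j → a j * ⟦ j ⟧) , λ y → begin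
      y * (G y - G (y - 1ℚ))
    ≡⟨ cong (y *_) (trans (cong₂ _-_ (expand y) (expand (y - 1ℚ))) (sym (∑-distrib-- (suc D) _ _))) ⟩
      y * ∑[ j < suc D ] (a j * falling y j - a j * falling (y - 1ℚ) j)
    ≡⟨ sym (*-distribˡ-∑ (suc D) y _) ⟩
      ∑[ j < suc D ] (y * (a j * falling y j - a j * falling (y - 1ℚ) j))
    ≡⟨ ∑-cong (suc D) (λ j _ → begin
           y * (a j * falling y j - a j * falling (y - 1ℚ) j)
         ≡⟨ solve 4 (λ y a f f′ → y :* (a :* f :- a :* f′) := a :* (y :* (f :- f′))) refl y (a j) (falling y j) (falling (y - 1ℚ) j) ⟩
           a j * (y * (falling y j - falling (y - 1ℚ) j))
         ≡⟨ cong (a j *_) (falling-Δ y j) ⟩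
           a j * (⟦ j ⟧ * falling y j)
         ≡⟨ sym (*-assoc (a j) ⟦ j ⟧ (falling y j)) ⟩
           a j * ⟦ j ⟧ * falling y j
         ∎) ⟩
      ∑[ j < suc D ] (a j * ⟦ j ⟧ * falling y j)
    ∎
    where open ≡-Reasoning

  expansion-y-shift : ∀ {D G} → FallingExpansion D G → FallingExpansion (suc D) (λ y → y * G (y - 1ℚ))
  expansion-y-shift {D} {G} (a , expand) = coeff , λ y → begin
      y * G (y - 1ℚ)
    ≡⟨ cong (y *_) (expand (y - 1ℚ)) ⟩
      y * ∑[ j < suc D ] (a j * falling (y - 1ℚ) j)
    ≡⟨ sym (*-distribˡ-∑ (suc D) y _) ⟩
      ∑[ j < suc D ] (y * (a j * falling (y - 1ℚ) j))
    ≡⟨ ∑-cong (suc D) (λ j _ → solve 3 (λ y a f → y :* (a :* f) := a :* (y :* f)) refl y (a j) (falling (y - 1ℚ) j)) ⟩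
      ∑[ j < suc D ] (a j * falling y (suc j))
    ≡⟨ sym (trans (cong (_+ ∑[ j < suc D ] (a j * falling y (suc j))) (*-zeroˡ 1ℚ)) (+-identityˡ _)) ⟩
      0ℚ * falling y 0 + ∑[ j < suc D ] (a j * falling y (suc j))
    ≡⟨ sym (∑-split-head (suc D) (λ j → coeff j * falling y j)) ⟩
      ∑[ j < suc (suc D) ] (coeff j * falling y j)
    ∎
    where
    open ≡-Reasoning
    coeff : ℕ → ℚ
    coeff zero = 0ℚ
    coeff (suc j) = a j

  deg-falling-∘ : ∀ j e {q} → Deg≤ e q → Deg≤ (j ℕ.* e) (λ u → falling (q u) j)
  deg-falling-∘ zero e dq = deg-const 0 1ℚ
  deg-falling-∘ (suc j) e {q} dq = deg-* e (j ℕ.* e) dq (deg-falling-∘ j e {λ u → q u - 1ℚ} (deg-- e dq (deg-const e 1ℚ)))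

  deg-∘ : ∀ D e {G q} → FallingExpansion D G → Deg≤ e q → Deg≤ (D ℕ.* e) (λ u → G (q u))
  deg-∘ D e {G} {q} (c , expand) dq = deg-cong (D ℕ.* e) (λ u → sym (expand (q u)))
    (deg-∑ (D ℕ.* e) (suc D) (λ j u → c j * falling (q u) j)
      (λ j j≤D → deg-scale (D ℕ.* e) (c j) (deg-mono (ℕ.*-monoˡ-≤ e (ℕ.≤-pred j≤D)) (deg-falling-∘ j e dq))))

  deg-quadratic : ∀ a σ → Deg≤ 2 (λ u → a + σ * (u * u))
  deg-quadratic a σ =
    deg-+ 2 {λ _ → a} (deg-const 2 a) (deg-scale 2 σ {λ u → u * u} (deg-* 1 1 {λ u → u} {λ u → u} deg-id deg-id))

  -N+i-squared : ∀ N i → i ℕ.≤ N ℕ.+ N → i ≢ N →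
    ∃ λ m → 1 ℕ.≤ m × m ℕ.≤ N × (- ⟦ N ⟧ + ⟦ i ⟧) * (- ⟦ N ⟧ + ⟦ i ⟧) ≡ ⟦ m ⟧ * ⟦ m ⟧
  -N+i-squared N i i≤2N i≢N with ℕ.<-cmp i N
  ... | tri< i<N _ _ = N ℕ.∸ i , ℕ.m<n⇒0<n∸m i<N , ℕ.m∸n≤m N i ,
        trans (cong (λ n → (- n + ⟦ i ⟧) * (- n + ⟦ i ⟧)) (sym (⟦⟧-homo-∸ (ℕ.<⇒≤ i<N))))
          (solve 2 (λ m i → (:- (m :+ i) :+ i) :* (:- (m :+ i) :+ i) := m :* m) refl ⟦ N ℕ.∸ i ⟧ ⟦ i ⟧)
  ... | tri≈ _ i≡N _ = ⊥-elim (i≢N i≡N)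
  ... | tri> _ _ N<i = i ℕ.∸ N , ℕ.m<n⇒0<n∸m N<i , ℕ.≤-trans (ℕ.∸-monoˡ-≤ N i≤2N) (ℕ.≤-reflexive (ℕ.m+n∸n≡m N N)) ,
        trans (cong (λ k → (- ⟦ N ⟧ + k) * (- ⟦ N ⟧ + k)) (sym (⟦⟧-homo-∸ (ℕ.<⇒≤ N<i))))
          (solve 2 (λ m n → (:- n :+ (m :+ n)) :* (:- n :+ (m :+ n)) := m :* m) refl ⟦ i ℕ.∸ N ⟧ ⟦ N ⟧)

  extrapolation-at-squares : ∀ D G → FallingExpansion D G → ∀ L σ r N → r ℕ.* (D ℕ.* 2) ℕ.< N ℕ.+ N →
    ∀ b → 0ℚ ≤ b → (∀ m → 1 ℕ.≤ m → m ℕ.≤ N → 0ℚ ≤ G (L + σ * (⟦ m ⟧ * ⟦ m ⟧)) × G (L + σ * (⟦ m ⟧ * ⟦ m ⟧)) ≤ b) →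
    1ℚ ≤ G L → 1ℚ ≤ ⟦ suc (N ℕ.+ N) ⟧ * b ^ r
  extrapolation-at-squares D G expG L σ r N 2rD<2N b 0≤b bound 1≤GL =
    extrapolation N (r ℕ.* (D ℕ.* 2)) H (deg-^ r (D ℕ.* 2) (deg-∘ D 2 expG (deg-quadratic L σ))) 2rD<2N
      (b ^ r) (^-nonNeg r 0≤b) H-bound 1≤H0
    where
    H : ℚ → ℚ
    H u = G (L + σ * (u * u)) ^ r
    1≤H0 : 1ℚ ≤ H 0ℚ
    1≤H0 = ≤-trans (≤-reflexive (sym (1^r≡1 r)))
      (≤-trans (^-mono-≤ r 0≤1 1≤GL) (≤-reflexive (cong (λ y → G y ^ r) (solve 2 (λ L s → L := L :+ s :* (con 0ℚ :* con 0ℚ)) refl L σ))))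
    H-bound : ∀ i → i ℕ.≤ N ℕ.+ N → i ≢ N → ∣ H (- ⟦ N ⟧ + ⟦ i ⟧) ∣ ≤ b ^ r
    H-bound i i≤2N i≢N with -N+i-squared N i i≤2N i≢N
    ... | m , 1≤m , m≤N , square with bound m 1≤m m≤N
    ...   | 0≤Gm , Gm≤b = ≤-trans (≤-reflexive (trans (cong (λ z → ∣ G (L + σ * z) ^ r ∣) square) (0≤p⇒∣p∣≡p (^-nonNeg r 0≤Gm))))
                                  (^-mono-≤ r 0≤Gm Gm≤b)

module SignAlternations where

  open import Data.Bool using (Bool; true; false; not)
  open import Data.Empty using (⊥-elim)
  open import Data.Nat as ℕ using (ℕ; zero; suc; s≤s)
  import Data.Nat.Properties as ℕ
  open import Data.Product using (∃; _×_; _,_)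
  open import Data.Rational
  open import Data.Rational.Properties
  open import Relation.Binary.PropositionalEquality
  open import Relation.Nullary using (¬_; Dec; yes; no)
  open RationalArithmetic
  open FiniteDifferences

  HasSign : Bool → ℚ → Set
  HasSign true x = 0ℚ < x
  HasSign false x = x < 0ℚ

  hasSign? : ∀ σ x → Dec (HasSign σ x)
  hasSign? true x = 0ℚ <? x
  hasSign? false x = x <? 0ℚ

  hasSign-not : ∀ σ {x} → HasSign σ x → ¬ HasSign (not σ) x
  hasSign-not true 0<x x<0 = <-asym 0<x x<0
  hasSign-not false x<0 0<x = <-asym x<0 0<x

  hasSign-difference : ∀ σ {x y} → ¬ HasSign σ x → HasSign σ y → HasSign σ (y - x)
  hasSign-difference true 0≮x 0<y = q<p⇒0<p-q (≤-<-trans (≮⇒≥ 0≮x) 0<y)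
  hasSign-difference false x≮0 y<0 = p<q⇒p-q<0 (<-≤-trans y<0 (≮⇒≥ x≮0))

  data Alternation (v : ℚ → ℚ) : ℕ → ℕ → Bool → Set where
    last : ∀ {a σ} → HasSign σ (v ⟦ a ⟧) → Alternation v 0 a σ
    _∷⟨_⟩_ : ∀ {s a b σ} → HasSign σ (v ⟦ a ⟧) → a ℕ.< b → Alternation v s b (not σ) → Alternation v (suc s) a σ

  alternation-head : ∀ {v s a σ} → Alternation v s a σ → HasSign σ (v ⟦ a ⟧)
  alternation-head (last sa) = sa
  alternation-head (sa ∷⟨ _ ⟩ _) = sa

  Δ-sign-between : ∀ (v : ℚ → ℚ) σ a b → a ℕ.< b → ¬ HasSign σ (v ⟦ a ⟧) → HasSign σ (v ⟦ b ⟧) →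
    ∃ λ k → a ℕ.≤ k × k ℕ.< b × HasSign σ (Δ 1ℚ v ⟦ k ⟧)
  Δ-sign-between v σ a (suc b) (s≤s a≤b) ¬sa sb with hasSign? σ (v ⟦ b ⟧)
  ... | no ¬sb = b , a≤b , ℕ.≤-refl ,
    subst (λ y → HasSign σ (v y - v ⟦ b ⟧)) (sym (+-comm ⟦ b ⟧ 1ℚ)) (hasSign-difference σ ¬sb sb)
  ... | yes sb′ with a ℕ.≟ b
  ...   | yes refl = ⊥-elim (¬sa sb′)
  ...   | no a≢b with Δ-sign-between v σ a b (ℕ.≤∧≢⇒< a≤b a≢b) ¬sa sb′
  ...     | k , a≤k , k<b , sk = k , a≤k , ℕ.m<n⇒m<1+n k<b , sk

  Δ-alternation : ∀ (v : ℚ → ℚ) s a σ → Alternation v (suc s) a σ → ∃ λ k → a ℕ.≤ k × Alternation (Δ 1ℚ v) s k (not σ)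
  Δ-alternation v s a σ (sa ∷⟨ a<b ⟩ rest) with Δ-sign-between v (not σ) a _ a<b (hasSign-not σ sa) (alternation-head rest)
  Δ-alternation v zero a σ (sa ∷⟨ a<b ⟩ rest) | k , a≤k , k<b , sk = k , a≤k , last sk
  Δ-alternation v (suc s) a σ (sa ∷⟨ a<b ⟩ rest) | k , a≤k , k<b , sk with Δ-alternation v s _ (not σ) rest
  ... | k′ , b≤k′ , rest′ = k , a≤k , (sk ∷⟨ ℕ.<-≤-trans k<b b≤k′ ⟩ rest′)

  Δ^-sign : ∀ s (v : ℚ → ℚ) a σ → Alternation v s a σ → ∃ λ k → ∃ λ τ → HasSign τ (Δ^ s v ⟦ k ⟧)
  Δ^-sign zero v a σ alt = a , σ , alternation-head alt
  Δ^-sign (suc s) v a σ alt with Δ-alternation v s a σ alt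
  ... | k , _ , alt′ = Δ^-sign s (Δ 1ℚ v) k (not σ) alt′

  deg-no-alternation : ∀ e (v : ℚ → ℚ) → Deg≤ e v → ∀ a σ → ¬ Alternation v (suc e) a σ
  deg-no-alternation e v dv a σ alt with Δ^-sign (suc e) v a σ alt
  ... | k , true , 0<Δ^v = <-irrefl (sym (Δ^-vanish (suc e) e dv ℕ.≤-refl ⟦ k ⟧)) 0<Δ^v
  ... | k , false , Δ^v<0 = <-irrefl (Δ^-vanish (suc e) e dv ℕ.≤-refl ⟦ k ⟧) Δ^v<0

module Symmetrization where

  open import Data.Bool using (Bool; true; false)
  open import Data.List using (List; []; _∷_; map; _++_; foldr)
  import Data.List.Properties as List
  open import Data.Nat as ℕ using (ℕ; zero; suc; z≤n; s≤s)
  import Data.Nat.Properties as ℕ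
  open import Data.Product using (_×_; _,_)
  open import Data.Rational
  open import Data.Rational.Properties
  open import Data.Rational.Solver using (module +-*-Solver)
  open import Data.Unit using (⊤; tt)
  open import Data.Vec using (Vec; []; _∷_)
  open import Defs
  open import Relation.Binary.PropositionalEquality
  open import Relation.Nullary using (yes; no)
  open +-*-Solver using (solve; _:=_; _:+_; _:*_; _:-_; :-_; con)
  open RationalArithmetic
  open FallingFactorials
    using (FallingExpansion; expansion-cong; expansion-const; expansion-+; expansion-scale; expansion-yΔ; expansion-y-shift)

  CubeFn : ℕ → Set
  CubeFn n = Input n → ℚ

  restrict₀ restrict₁ ∂ : ∀ {n} → CubeFn (suc n) → CubeFn n
  restrict₀ g x = g (false ∷ x)
  restrict₁ g x = g (true ∷ x)
  ∂ g x = g (true ∷ x) - g (false ∷ x)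

  ∂-zero : ∀ {n} (g : CubeFn (suc n)) x → ∂ g x ≡ 0ℚ → g (true ∷ x) ≡ g (false ∷ x)
  ∂-zero g x = p-q≡0⇒p≡q {g (true ∷ x)} {g (false ∷ x)}

  -- Multilinear degree, read off from g (b ∷ x) = restrict₀ g x + b · ∂ g x; MultiDeg< 0 means identically 0.
  MultiDeg≤ MultiDeg< : ℕ → (n : ℕ) → CubeFn n → Set
  MultiDeg≤ d zero g = ⊤
  MultiDeg≤ d (suc n) g = MultiDeg≤ d n (restrict₀ g) × MultiDeg< d n (∂ g)
  MultiDeg< zero n h = ∀ x → h x ≡ 0ℚ
  MultiDeg< (suc d) n h = MultiDeg≤ d n h

  mdeg≤-cong : ∀ d n {g h} → (∀ x → g x ≡ h x) → MultiDeg≤ d n g → MultiDeg≤ d n h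
  mdeg<-cong : ∀ d n {g h} → (∀ x → g x ≡ h x) → MultiDeg< d n g → MultiDeg< d n h
  mdeg≤-cong d zero g≗h _ = tt
  mdeg≤-cong d (suc n) g≗h (g₀ , ∂g) = mdeg≤-cong d n (λ x → g≗h (false ∷ x)) g₀ ,
                                       mdeg<-cong d n (λ x → cong₂ _-_ (g≗h (true ∷ x)) (g≗h (false ∷ x))) ∂g
  mdeg<-cong zero n g≗h g≡0 x = trans (sym (g≗h x)) (g≡0 x)
  mdeg<-cong (suc d) n g≗h dg = mdeg≤-cong d n g≗h dg

  mdeg≤-zero : ∀ d n → MultiDeg≤ d n (λ _ → 0ℚ)
  mdeg<-zero : ∀ d n → MultiDeg< d n (λ _ → 0ℚ)
  mdeg≤-zero d zero = tt
  mdeg≤-zero d (suc n) = mdeg≤-zero d n , mdeg<-cong d n (λ _ → sym (p-p≡0 0ℚ)) (mdeg<-zero d n)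
  mdeg<-zero zero n x = refl
  mdeg<-zero (suc d) n = mdeg≤-zero d n

  mdeg≤-+ : ∀ d n {g h} → MultiDeg≤ d n g → MultiDeg≤ d n h → MultiDeg≤ d n (λ x → g x + h x)
  mdeg<-+ : ∀ d n {g h} → MultiDeg< d n g → MultiDeg< d n h → MultiDeg< d n (λ x → g x + h x)
  mdeg≤-+ d zero _ _ = tt
  mdeg≤-+ d (suc n) {g} {h} (g₀ , ∂g) (h₀ , ∂h) = mdeg≤-+ d n g₀ h₀ ,
    mdeg<-cong d n (λ x → solve 4 (λ a b c e → (a :- b) :+ (c :- e) := (a :+ c) :- (b :+ e)) refl
                             (g (true ∷ x)) (g (false ∷ x)) (h (true ∷ x)) (h (false ∷ x)))
      (mdeg<-+ d n ∂g ∂h)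
  mdeg<-+ zero n g≡0 h≡0 x = trans (cong₂ _+_ (g≡0 x) (h≡0 x)) (+-identityˡ 0ℚ)
  mdeg<-+ (suc d) n dg dh = mdeg≤-+ d n dg dh

  mdeg≤-suc : ∀ d n {g} → MultiDeg≤ d n g → MultiDeg≤ (suc d) n g
  mdeg<⇒mdeg≤ : ∀ d n {g} → MultiDeg< d n g → MultiDeg≤ d n g
  mdeg≤-suc d zero _ = tt
  mdeg≤-suc d (suc n) (g₀ , ∂g) = mdeg≤-suc d n g₀ , mdeg<⇒mdeg≤ d n ∂g
  mdeg<⇒mdeg≤ zero n g≡0 = mdeg≤-cong zero n (λ x → sym (g≡0 x)) (mdeg≤-zero zero n)
  mdeg<⇒mdeg≤ (suc d) n dg = mdeg≤-suc d n dg

  mdeg≤-restrict₁ : ∀ d n {g} → MultiDeg≤ d (suc n) g → MultiDeg≤ d n (restrict₁ g)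
  mdeg≤-restrict₁ d n {g} (g₀ , ∂g) = mdeg≤-cong d n (λ x → solve 2 (λ a b → b :+ (a :- b) := a) refl (g (true ∷ x)) (g (false ∷ x)))
    (mdeg≤-+ d n g₀ (mdeg<⇒mdeg≤ d n ∂g))

  mdeg≤-* : ∀ a b n {g h} → MultiDeg≤ a n g → MultiDeg≤ b n h → MultiDeg≤ (a ℕ.+ b) n (λ x → g x * h x)
  mdeg≤-* a b zero _ _ = tt
  mdeg≤-* zero zero (suc n) {g} {h} (g₀ , ∂g) (h₀ , ∂h) = mdeg≤-* zero zero n g₀ h₀ ,
    λ x → trans (cong₂ (λ u v → u * v - g (false ∷ x) * h (false ∷ x)) (∂-zero g x (∂g x)) (∂-zero h x (∂h x)))
                (p-p≡0 (g (false ∷ x) * h (false ∷ x)))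
  mdeg≤-* zero (suc b) (suc n) {g} {h} (g₀ , ∂g) (h₀ , ∂h) = mdeg≤-* zero (suc b) n g₀ h₀ ,
    mdeg≤-cong b n (λ x → trans (*-distribˡ-- (g (false ∷ x)) (h (true ∷ x)) (h (false ∷ x)))
                               (cong (λ u → u * h (true ∷ x) - g (false ∷ x) * h (false ∷ x)) (sym (∂-zero g x (∂g x)))))
      (mdeg≤-* zero b n {restrict₀ g} {∂ h} g₀ ∂h)
  mdeg≤-* (suc a) zero (suc n) {g} {h} (g₀ , ∂g) (h₀ , ∂h) = mdeg≤-* (suc a) zero n g₀ h₀ ,
    mdeg≤-cong (a ℕ.+ 0) n (λ x → trans (solve 3 (λ u w v → (u :- w) :* v := u :* v :- w :* v) refl (g (true ∷ x)) (g (false ∷ x)) (h (false ∷ x)))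
                                       (cong (λ v → g (true ∷ x) * v - g (false ∷ x) * h (false ∷ x)) (sym (∂-zero h x (∂h x)))))
      (mdeg≤-* a zero n {∂ g} {restrict₀ h} ∂g h₀)
  mdeg≤-* (suc a) (suc b) (suc n) {g} {h} (g₀ , ∂g) (h₀ , ∂h) = mdeg≤-* (suc a) (suc b) n g₀ h₀ ,
    mdeg≤-cong (a ℕ.+ suc b) n (λ x → solve 4 (λ p q r s → (p :- q) :* r :+ q :* (r :- s) := p :* r :- q :* s) refl
                                        (g (true ∷ x)) (g (false ∷ x)) (h (true ∷ x)) (h (false ∷ x)))
      (mdeg≤-+ (a ℕ.+ suc b) n (mdeg≤-* a (suc b) n {∂ g} {restrict₁ h} ∂g (mdeg≤-restrict₁ (suc b) n {h} (h₀ , ∂h)))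
        (subst (λ k → MultiDeg≤ k n (λ x → restrict₀ g x * ∂ h x)) (sym (ℕ.+-suc a b))
          (mdeg≤-* (suc a) b n {restrict₀ g} {∂ h} g₀ ∂h)))

  private
    term : ∀ {n} → Poly n → Input n → Vec Bool n → ℚ → ℚ
    term c x S acc = c S * monomial S x + acc

    foldr-term-acc : ∀ {n} (c : Poly n) x a (Ss : List (Vec Bool n)) → foldr (term c x) a Ss ≡ foldr (term c x) 0ℚ Ss + a
    foldr-term-acc c x a [] = sym (+-identityˡ a)
    foldr-term-acc c x a (S ∷ Ss) = trans (cong (term c x S) (foldr-term-acc c x a Ss))
      (sym (+-assoc (c S * monomial S x) (foldr (term c x) 0ℚ Ss) a))

    foldr-term-false : ∀ {n} (c : Poly (suc n)) b x a (Ss : List (Vec Bool n)) →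
      foldr (term c (b ∷ x)) a (map (false ∷_) Ss) ≡ foldr (term (λ S → c (false ∷ S)) x) a Ss
    foldr-term-false c b x a [] = refl
    foldr-term-false c b x a (S ∷ Ss) = cong (term c (b ∷ x) (false ∷ S)) (foldr-term-false c b x a Ss)

    foldr-term-true : ∀ {n} (c : Poly (suc n)) b x (Ss : List (Vec Bool n)) →
      foldr (term c (b ∷ x)) 0ℚ (map (true ∷_) Ss) ≡ toℚ b * foldr (term (λ S → c (true ∷ S)) x) 0ℚ Ss
    foldr-term-true c b x [] = sym (*-zeroʳ (toℚ b))
    foldr-term-true c b x (S ∷ Ss) = trans (cong (term c (b ∷ x) (true ∷ S)) (foldr-term-true c b x Ss))
      (solve 4 (λ c t m r → c :* (t :* m) :+ t :* r := t :* (c :* m :+ r)) refl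
        (c (true ∷ S)) (toℚ b) (monomial S x) (foldr (term (λ S → c (true ∷ S)) x) 0ℚ Ss))

  evalPoly-∷ : ∀ {n} (c : Poly (suc n)) b x →
    evalPoly c (b ∷ x) ≡ evalPoly (λ S → c (false ∷ S)) x + toℚ b * evalPoly (λ S → c (true ∷ S)) x
  evalPoly-∷ {n} c b x = begin
      foldr (term c (b ∷ x)) 0ℚ (map (false ∷_) Ss ++ map (true ∷_) Ss)
    ≡⟨ List.foldr-++ (term c (b ∷ x)) 0ℚ (map (false ∷_) Ss) (map (true ∷_) Ss) ⟩
      foldr (term c (b ∷ x)) (foldr (term c (b ∷ x)) 0ℚ (map (true ∷_) Ss)) (map (false ∷_) Ss)
    ≡⟨ foldr-term-false c b x _ Ss ⟩
      foldr (term (λ S → c (false ∷ S)) x) (foldr (term c (b ∷ x)) 0ℚ (map (true ∷_) Ss)) Ss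
    ≡⟨ foldr-term-acc (λ S → c (false ∷ S)) x _ Ss ⟩
      evalPoly (λ S → c (false ∷ S)) x + foldr (term c (b ∷ x)) 0ℚ (map (true ∷_) Ss)
    ≡⟨ cong (evalPoly (λ S → c (false ∷ S)) x +_) (foldr-term-true c b x Ss) ⟩
      evalPoly (λ S → c (false ∷ S)) x + toℚ b * evalPoly (λ S → c (true ∷ S)) x
    ∎
    where
    open ≡-Reasoning
    Ss = allSubsets n

  evalPoly-restrict₀ : ∀ {n} (c : Poly (suc n)) x → restrict₀ (evalPoly c) x ≡ evalPoly (λ S → c (false ∷ S)) x
  evalPoly-restrict₀ c x = trans (evalPoly-∷ c false x)
    (trans (cong (evalPoly (λ S → c (false ∷ S)) x +_) (*-zeroˡ (evalPoly (λ S → c (true ∷ S)) x))) (+-identityʳ _))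

  evalPoly-∂ : ∀ {n} (c : Poly (suc n)) x → ∂ (evalPoly c) x ≡ evalPoly (λ S → c (true ∷ S)) x
  evalPoly-∂ c x = trans (cong₂ _-_ (evalPoly-∷ c true x) (evalPoly-∷ c false x))
    (solve 2 (λ a b → a :+ con 1ℚ :* b :- (a :+ con 0ℚ :* b) := b) refl
      (evalPoly (λ S → c (false ∷ S)) x) (evalPoly (λ S → c (true ∷ S)) x))

  evalPoly-zero : ∀ {n} (c : Poly n) x → (∀ S → c S ≡ 0ℚ) → evalPoly c x ≡ 0ℚ
  evalPoly-zero {n} c x c≡0 = go (allSubsets n)
    where
    go : ∀ Ss → foldr (term c x) 0ℚ Ss ≡ 0ℚ
    go [] = refl
    go (S ∷ Ss) = trans (cong₂ (λ u v → u * monomial S x + v) (c≡0 S) (go Ss))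
      (trans (cong (_+ 0ℚ) (*-zeroˡ (monomial S x))) (+-identityˡ 0ℚ))

  evalPoly-mdeg≤ : ∀ d n (c : Poly n) → DegreeAtMost d c → MultiDeg≤ d n (evalPoly c)
  evalPoly-mdeg< : ∀ d n (c : Poly n) → (∀ S → d ℕ.≤ weight S → c S ≡ 0ℚ) → MultiDeg< d n (evalPoly c)
  evalPoly-mdeg≤ d zero c _ = tt
  evalPoly-mdeg≤ d (suc n) c deg =
    mdeg≤-cong d n (λ x → sym (evalPoly-restrict₀ c x)) (evalPoly-mdeg≤ d n (λ S → c (false ∷ S)) (λ S → deg (false ∷ S))) ,
    mdeg<-cong d n (λ x → sym (evalPoly-∂ c x)) (evalPoly-mdeg< d n (λ S → c (true ∷ S)) (λ S d≤w → deg (true ∷ S) (s≤s d≤w)))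
  evalPoly-mdeg< zero n c vanish x = evalPoly-zero c x (λ S → vanish S z≤n)
  evalPoly-mdeg< (suc d) n c vanish = evalPoly-mdeg≤ d n c vanish

  inv : ℕ → ℚ
  inv n = 1/_ ⟦ suc n ⟧ {{pos⇒nonZero ⟦ suc n ⟧ {{positive (⟦suc⟧-pos n)}}}}

  ⟦suc⟧*inv : ∀ n → ⟦ suc n ⟧ * inv n ≡ 1ℚ
  ⟦suc⟧*inv n = *-inverseʳ ⟦ suc n ⟧ {{pos⇒nonZero ⟦ suc n ⟧ {{positive (⟦suc⟧-pos n)}}}}

  inv-nonNeg : ∀ n → 0ℚ ≤ inv n
  inv-nonNeg n = <⇒≤ (positive⁻¹ (inv n) {{1/pos⇒pos ⟦ suc n ⟧ {{positive (⟦suc⟧-pos n)}}}})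

  -- At k ∈ {0,…,n+1}, symmetrize (suc n) g ⟦ k ⟧ is the average of g over the inputs of weight k, since a
  -- uniformly random such input starts with 1 with probability k/(n+1).
  symmetrize : (n : ℕ) → CubeFn n → ℚ → ℚ
  symmetrize zero g k = g []
  symmetrize (suc n) g k = (1ℚ - k * inv n) * symmetrize n (restrict₀ g) k + (k * inv n) * symmetrize n (restrict₁ g) (k - 1ℚ)

  symmetrize-cong : ∀ n {g h : CubeFn n} → (∀ x → g x ≡ h x) → ∀ k → symmetrize n g k ≡ symmetrize n h k
  symmetrize-cong zero g≗h k = g≗h []
  symmetrize-cong (suc n) g≗h k = cong₂ (λ u v → (1ℚ - k * inv n) * u + (k * inv n) * v)
    (symmetrize-cong n (λ x → g≗h (false ∷ x)) k) (symmetrize-cong n (λ x → g≗h (true ∷ x)) (k - 1ℚ))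

  symmetrize-const : ∀ n c k → symmetrize n (λ _ → c) k ≡ c
  symmetrize-const zero c k = refl
  symmetrize-const (suc n) c k = trans (cong₂ (λ u v → (1ℚ - k * inv n) * u + (k * inv n) * v)
                                              (symmetrize-const n c k) (symmetrize-const n c (k - 1ℚ)))
    (solve 2 (λ α c → (con 1ℚ :- α) :* c :+ α :* c := c) refl (k * inv n) c)

  symmetrize-+ : ∀ n (g h : CubeFn n) k → symmetrize n (λ x → g x + h x) k ≡ symmetrize n g k + symmetrize n h k
  symmetrize-+ zero g h k = refl
  symmetrize-+ (suc n) g h k = trans (cong₂ (λ u v → (1ℚ - k * inv n) * u + (k * inv n) * v)
                                          (symmetrize-+ n (restrict₀ g) (restrict₀ h) k) (symmetrize-+ n (restrict₁ g) (restrict₁ h) (k - 1ℚ)))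
    (solve 6 (λ α β a b c d → α :* (a :+ b) :+ β :* (c :+ d) := (α :* a :+ β :* c) :+ (α :* b :+ β :* d)) refl
      (1ℚ - k * inv n) (k * inv n) (symmetrize n (restrict₀ g) k) (symmetrize n (restrict₀ h) k)
      (symmetrize n (restrict₁ g) (k - 1ℚ)) (symmetrize n (restrict₁ h) (k - 1ℚ)))

  symmetrize-suc : ∀ n g y → let X = symmetrize n (restrict₀ g) in
    symmetrize (suc n) g y ≡ X y + (- inv n) * (y * (X y - X (y - 1ℚ))) + inv n * (y * symmetrize n (∂ g) (y - 1ℚ))
  symmetrize-suc n g y = begin
      (1ℚ - y * inv n) * X y + (y * inv n) * symmetrize n (restrict₁ g) (y - 1ℚ)
    ≡⟨ cong (λ z → (1ℚ - y * inv n) * X y + (y * inv n) * z)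
         (trans (symmetrize-cong n (λ x → solve 2 (λ a b → a := b :+ (a :- b)) refl (g (true ∷ x)) (g (false ∷ x))) (y - 1ℚ))
                (symmetrize-+ n (restrict₀ g) (∂ g) (y - 1ℚ))) ⟩
      (1ℚ - y * inv n) * X y + (y * inv n) * (X (y - 1ℚ) + symmetrize n (∂ g) (y - 1ℚ))
    ≡⟨ solve 5 (λ y ι a a′ s → (con 1ℚ :- y :* ι) :* a :+ (y :* ι) :* (a′ :+ s) := a :+ (:- ι) :* (y :* (a :- a′)) :+ ι :* (y :* s)) refl
         y (inv n) (X y) (X (y - 1ℚ)) (symmetrize n (∂ g) (y - 1ℚ)) ⟩
      X y + (- inv n) * (y * (X y - X (y - 1ℚ))) + inv n * (y * symmetrize n (∂ g) (y - 1ℚ))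
    ∎
    where
    open ≡-Reasoning
    X = symmetrize n (restrict₀ g)

  symmetrize-expansion : ∀ d n g → MultiDeg≤ d n g → FallingExpansion d (symmetrize n g)
  symmetrize-expansion d zero g _ = expansion-const d (g [])
  symmetrize-expansion d (suc n) g (g₀ , ∂g) = expansion-cong (λ y → sym (symmetrize-suc n g y))
    (expansion-+ (expansion-+ X-expansion (expansion-scale (- inv n) (expansion-yΔ X-expansion)))
      (expansion-scale (inv n) (∂-expansion d ∂g)))
    where
    X = symmetrize n (restrict₀ g)
    X-expansion : FallingExpansion d X
    X-expansion = symmetrize-expansion d n (restrict₀ g) g₀
    ∂-expansion : ∀ d → MultiDeg< d n (∂ g) → FallingExpansion d (λ y → y * symmetrize n (∂ g) (y - 1ℚ))
    ∂-expansion zero ∂g≡0 = expansion-cong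
      (λ y → sym (trans (cong (y *_) (trans (symmetrize-cong n ∂g≡0 (y - 1ℚ)) (symmetrize-const n 0ℚ (y - 1ℚ)))) (*-zeroʳ y)))
      (expansion-const 0 0ℚ)
    ∂-expansion (suc d) ∂g = expansion-y-shift (symmetrize-expansion d n (∂ g) ∂g)

  Convex : (ℚ → Set) → Set
  Convex P = ∀ {α x y} → 0ℚ ≤ α → α ≤ 1ℚ → P x → P y → P ((1ℚ - α) * x + α * y)

  ≥-convex : ∀ lo → Convex (lo ≤_)
  ≥-convex lo {α} 0≤α α≤1 lo≤x lo≤y = ≤-trans (≤-reflexive (solve 2 (λ l a → l := (con 1ℚ :- a) :* l :+ a :* l) refl lo α))
    (+-mono-≤ (*-monoˡ-≤-≥0 (q≤p⇒0≤p-q α≤1) lo≤x) (*-monoˡ-≤-≥0 0≤α lo≤y))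

  ≤-convex : ∀ hi → Convex (_≤ hi)
  ≤-convex hi {α} 0≤α α≤1 x≤hi y≤hi = ≤-trans (+-mono-≤ (*-monoˡ-≤-≥0 (q≤p⇒0≤p-q α≤1) x≤hi) (*-monoˡ-≤-≥0 0≤α y≤hi))
    (≤-reflexive (solve 2 (λ h a → (con 1ℚ :- a) :* h :+ a :* h := h) refl hi α))

  symmetrize-convex : ∀ P → Convex P → ∀ n (g : CubeFn n) k → k ℕ.≤ n →
    (∀ x → weight x ≡ k → P (g x)) → P (symmetrize n g ⟦ k ⟧)
  symmetrize-convex P conv zero g zero _ Pg = Pg [] refl
  symmetrize-convex P conv (suc n) g zero _ Pg =
    subst P (solve 3 (λ ι a b → a := (con 1ℚ :- con 0ℚ :* ι) :* a :+ (con 0ℚ :* ι) :* b) refl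
              (inv n) (symmetrize n (restrict₀ g) 0ℚ) (symmetrize n (restrict₁ g) (0ℚ - 1ℚ)))
      (symmetrize-convex P conv n (restrict₀ g) 0 z≤n (λ x → Pg (false ∷ x)))
  symmetrize-convex P conv (suc n) g (suc k) (s≤s k≤n) Pg with k ℕ.≟ n
  ... | yes refl = subst P (begin
        symmetrize k (restrict₁ g) ⟦ k ⟧
      ≡⟨ solve 2 (λ a b → b := (con 1ℚ :- con 1ℚ) :* a :+ con 1ℚ :* b) refl (symmetrize k (restrict₀ g) ⟦ suc k ⟧) _ ⟩
        (1ℚ - 1ℚ) * symmetrize k (restrict₀ g) ⟦ suc k ⟧ + 1ℚ * symmetrize k (restrict₁ g) ⟦ k ⟧
      ≡⟨ cong₂ (λ α z → (1ℚ - α) * symmetrize k (restrict₀ g) ⟦ suc k ⟧ + α * symmetrize k (restrict₁ g) z)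
           (sym (⟦suc⟧*inv k)) (sym (⟦suc⟧-1 k)) ⟩
        symmetrize (suc k) g ⟦ suc k ⟧
      ∎)
      (symmetrize-convex P conv k (restrict₁ g) k k≤n (λ x w → Pg (true ∷ x) (cong suc w)))
    where open ≡-Reasoning
  ... | no k≢n = subst P (cong (λ z → (1ℚ - α) * symmetrize n (restrict₀ g) ⟦ suc k ⟧ + α * symmetrize n (restrict₁ g) z)
                               (sym (⟦suc⟧-1 k)))
      (conv (*-≥0 (⟦⟧-nonNeg (suc k)) (inv-nonNeg n))
            (≤-trans (*-monoʳ-≤-≥0 (inv-nonNeg n) (⟦⟧-mono-≤ (ℕ.m≤n⇒m≤1+n (ℕ.≤∧≢⇒< k≤n k≢n)))) (≤-reflexive (⟦suc⟧*inv n)))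
            (symmetrize-convex P conv n (restrict₀ g) (suc k) (ℕ.≤∧≢⇒< k≤n k≢n) (λ x → Pg (false ∷ x)))
            (symmetrize-convex P conv n (restrict₁ g) k k≤n (λ x w → Pg (true ∷ x) (cong suc w))))
    where
    α = ⟦ suc k ⟧ * inv n

module SymmetricFunctions where

  open import Data.Bool as Bool using (Bool; true; false; not)
  open import Data.Bool.Properties using (¬-not; not-¬)
  open import Data.Empty using (⊥-elim)
  import Data.Integer as ℤ
  open import Data.Nat as ℕ using (ℕ; zero; suc; z≤n; s≤s)
  import Data.Nat.Properties as ℕ
  open import Data.Nat.Tactic.RingSolver using (solve-∀)
  open import Data.Product using (∃; _×_; _,_; proj₁; proj₂)
  open import Data.Rational
  open import Data.Rational.Properties
  open import Data.Rational.Solver using (module +-*-Solver)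
  open import Data.Sum as Sum using (_⊎_; inj₁; inj₂)
  open import Data.Vec using ([]; _∷_)
  open import Defs
  open import Function using (_∘_)
  open import Relation.Binary.PropositionalEquality
  open import Relation.Nullary using (¬_; yes; no)
  open import Relation.Nullary.Decidable using (from-yes; decidable-stable)
  open +-*-Solver using (solve; _:=_; _:+_; _:*_; con)
  open RationalArithmetic
  open FiniteDifferences
  open FallingFactorials
  open SignAlternations
  open Symmetrization

  module Runs (n W : ℕ) (F : ℕ → Bool) (R : ℚ → ℚ)
    (sign : ∀ k → k ℕ.≤ n → HasSign (F k) (R ⟦ k ⟧))
    (backward : ∀ L → L ℕ.≤ n → W ℕ.≤ L → ¬ (∀ j → L ℕ.∸ W ℕ.≤ j → j ℕ.< L → F j ≢ F L))
    (forward : ∀ L → L ℕ.+ W ℕ.≤ n → ¬ (∀ j → L ℕ.< j → j ℕ.≤ L ℕ.+ W → F j ≢ F L)) where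

    change-within : ∀ {a t} → t ℕ.≤ n → F t ≢ F a → (∀ j → a ℕ.≤ j → j ℕ.< t → F j ≡ F a) → t ℕ.< a ℕ.+ W
    change-within {a} {t} t≤n Ft≢Fa run with a ℕ.+ W ℕ.≤? t
    ... | no a+W≰t = ℕ.≰⇒> a+W≰t
    ... | yes a+W≤t = ⊥-elim (backward t t≤n (ℕ.≤-trans (ℕ.m≤n+m W a) a+W≤t)
            (λ j t∸W≤j j<t Fj≡Ft → Ft≢Fa (trans (sym Fj≡Ft) (run j (ℕ.≤-trans (ℕ.m+n≤o⇒m≤o∸n a a+W≤t) t∸W≤j) j<t))))

    last-run-short : ∀ L → (∀ j → L ℕ.< j → j ℕ.≤ n → F j ≢ F L) → n ℕ.< L ℕ.+ W
    last-run-short L others with L ℕ.+ W ℕ.≤? n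
    ... | no L+W≰n = ℕ.≰⇒> L+W≰n
    ... | yes L+W≤n = ⊥-elim (forward L L+W≤n (λ j L<j j≤L+W → others j L<j (ℕ.≤-trans j≤L+W L+W≤n)))

    ConstantFrom : ℕ → Set
    ConstantFrom a = ∀ j → a ℕ.≤ j → j ℕ.≤ n → F j ≡ F a

    -- bound holds because each run of F after next is shorter than W.
    record AlternatesFrom (a : ℕ) : Set where
      field
        changes next : ℕ
        a<next : a ℕ.< next
        next≤n : next ℕ.≤ n
        F-next : F next ≢ F a
        run : ∀ j → a ℕ.≤ j → j ℕ.< next → F j ≡ F a
        alternation : Alternation R changes next (F next)
        bound : n ℕ.< next ℕ.+ suc changes ℕ.* W

    extend-run : ∀ {a} {Q : ℕ → Set} → F a ≡ F (suc a) → (∀ j → suc a ℕ.≤ j → Q j → F j ≡ F (suc a)) →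
      ∀ j → a ℕ.≤ j → Q j → F j ≡ F a
    extend-run {a} same run j a≤j Qj with ℕ.m≤n⇒m<n∨m≡n a≤j
    ... | inj₁ a<j = trans (run j a<j Qj) (sym same)
    ... | inj₂ refl = refl

    constant⊎alternates : ∀ i a → a ℕ.+ i ≡ n → ConstantFrom a ⊎ AlternatesFrom a
    constant⊎alternates zero a a+0≡n = inj₁ (λ j a≤j j≤n → cong F (ℕ.≤-antisym (ℕ.≤-trans j≤n (ℕ.≤-reflexive (sym a≡n))) a≤j))
      where a≡n = trans (sym (ℕ.+-identityʳ a)) a+0≡n
    constant⊎alternates (suc i) a a+1+i≡n with constant⊎alternates i (suc a) (trans (sym (ℕ.+-suc a i)) a+1+i≡n) | F a Bool.≟ F (suc a)
    ... | inj₁ constant | yes same = inj₁ (extend-run same constant)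
    ... | inj₁ constant | no differ = inj₂ record
      { changes = 0 ; next = suc a ; a<next = ℕ.≤-refl ; next≤n = 1+a≤n ; F-next = differ ∘ sym
      ; run = λ j a≤j j<1+a → cong F (ℕ.≤-antisym (ℕ.≤-pred j<1+a) a≤j)
      ; alternation = last (sign (suc a) 1+a≤n)
      ; bound = ℕ.<-≤-trans (last-run-short a (λ j a<j j≤n Fj≡Fa → differ (trans (sym Fj≡Fa) (constant j a<j j≤n))))
                            (ℕ.+-mono-≤ (ℕ.n≤1+n a) (ℕ.≤-reflexive (sym (ℕ.+-identityʳ W))))
      }
      where 1+a≤n = ℕ.≤-trans (ℕ.m≤m+n (suc a) i) (ℕ.≤-reflexive (trans (sym (ℕ.+-suc a i)) a+1+i≡n))
    ... | inj₂ alt | yes same = inj₂ record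
      { changes = changes ; next = next ; a<next = ℕ.<-trans (ℕ.n<1+n a) a<next ; next≤n = next≤n
      ; F-next = λ eq → F-next (trans eq same)
      ; run = extend-run same run
      ; alternation = alternation ; bound = bound
      }
      where open AlternatesFrom alt
    ... | inj₂ alt | no differ = inj₂ record
      { changes = suc changes ; next = suc a ; a<next = ℕ.≤-refl ; next≤n = ℕ.≤-trans (ℕ.<⇒≤ a<next) next≤n
      ; F-next = differ ∘ sym
      ; run = λ j a≤j j<1+a → cong F (ℕ.≤-antisym (ℕ.≤-pred j<1+a) a≤j)
      ; alternation = sign (suc a) (ℕ.≤-trans (ℕ.<⇒≤ a<next) next≤n) ∷⟨ a<next ⟩
                        subst (Alternation R changes next) (¬-not F-next) alternation
      ; bound = ℕ.<-≤-trans bound (ℕ.≤-trans (ℕ.+-monoˡ-≤ (suc changes ℕ.* W) (ℕ.<⇒≤ (change-within next≤n F-next run)))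
                                             (ℕ.≤-reflexive (ℕ.+-assoc (suc a) W _)))
      }
      where open AlternatesFrom alt

    constant⊎alternation : (∀ j → j ℕ.≤ n → F j ≡ F 0) ⊎ (∃ λ s → Alternation R (suc s) 0 (F 0) × n ℕ.< suc (suc s) ℕ.* W)
    constant⊎alternation with constant⊎alternates n 0 refl
    ... | inj₁ constant = inj₁ (λ j → constant j z≤n)
    ... | inj₂ alt = inj₂ (changes , (sign 0 z≤n ∷⟨ a<next ⟩ subst (Alternation R changes next) (¬-not F-next) alternation) ,
                           ℕ.<-≤-trans bound (ℕ.+-monoˡ-≤ (suc changes ℕ.* W) (ℕ.<⇒≤ (change-within next≤n F-next run))))
      where open AlternatesFrom alt

  ninth : ℚ
  ninth = ℤ.+ 1 / 9

  0≤ninth : 0ℚ ≤ ninth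
  0≤ninth = from-yes (0ℚ ≤? ninth)

  ninth<1 : ninth < 1ℚ
  ninth<1 = from-yes (ninth <? 1ℚ)

  ⟦⟧*ninth^r<1 : ∀ M r → M ℕ.< 9 ℕ.^ r → ⟦ M ⟧ * ninth ^ r < 1ℚ
  ⟦⟧*ninth^r<1 M r M<9^r = begin-strict
      ⟦ M ⟧ * ninth ^ r
    <⟨ *-monoˡ-<-pos (ninth ^ r) {{positive (^-pos r (from-yes (0ℚ <? ninth)))}} (⟦⟧-mono-< M<9^r) ⟩
      ⟦ 9 ℕ.^ r ⟧ * ninth ^ r
    ≡⟨ cong (_* ninth ^ r) (⟦⟧-homo-^ 9 r) ⟩
      ⟦ 9 ⟧ ^ r * ninth ^ r
    ≡⟨ sym (^-distrib-* ⟦ 9 ⟧ ninth r) ⟩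
      (⟦ 9 ⟧ * ninth) ^ r
    ≡⟨ 1^r≡1 r ⟩
      1ℚ
    ∎
    where open ≤-Reasoning

  [1+n]²≤9^n : ∀ n → suc n ℕ.* suc n ℕ.≤ 9 ℕ.^ n
  [1+n]²≤9^n zero = ℕ.≤-refl
  [1+n]²≤9^n (suc n) = ℕ.≤-trans (ℕ.≤-trans (ℕ.m≤m+n _ (8 ℕ.* (n ℕ.* n) ℕ.+ 14 ℕ.* n ℕ.+ 5)) (ℕ.≤-reflexive (expand n)))
                                   (ℕ.*-monoʳ-≤ 9 ([1+n]²≤9^n n))
    where
    expand : ∀ n → suc (suc n) ℕ.* suc (suc n) ℕ.+ (8 ℕ.* (n ℕ.* n) ℕ.+ 14 ℕ.* n ℕ.+ 5) ≡ 9 ℕ.* (suc n ℕ.* suc n)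
    expand = solve-∀

  1+2N<9^[1+D] : ∀ D → suc (suc (suc D ℕ.* D) ℕ.+ suc (suc D ℕ.* D)) ℕ.< 9 ℕ.^ suc D
  1+2N<9^[1+D] D = ℕ.≤-trans (ℕ.≤-trans (ℕ.m≤m+n _ (7 ℕ.* (D ℕ.* D) ℕ.+ 16 ℕ.* D ℕ.+ 5)) (ℕ.≤-reflexive (expand D)))
                             (ℕ.*-monoʳ-≤ 9 ([1+n]²≤9^n D))
    where
    expand : ∀ D → suc (suc (suc (suc D ℕ.* D) ℕ.+ suc (suc D ℕ.* D))) ℕ.+ (7 ℕ.* (D ℕ.* D) ℕ.+ 16 ℕ.* D ℕ.+ 5)
                   ≡ 9 ℕ.* (suc D ℕ.* suc D)
    expand = solve-∀

  Small : ℚ → Set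
  Small y = 0ℚ ≤ y × y ≤ ninth

  record Separates (n : ℕ) (F : ℕ → Bool) (σ : Bool) (G : ℚ → ℚ) : Set where
    field
      large : ∀ k → k ℕ.≤ n → F k ≡ σ → 1ℚ ≤ G ⟦ k ⟧
      small : ∀ k → k ℕ.≤ n → F k ≢ σ → Small (G ⟦ k ⟧)

  module Separated (n : ℕ) (F : ℕ → Bool) (D : ℕ) (P Q : ℚ → ℚ)
    (expP : FallingExpansion D P) (expQ : FallingExpansion D Q)
    (sepP : Separates n F true P) (sepQ : Separates n F false Q) where

    separator : Bool → ℚ → ℚ
    separator true = P
    separator false = Q

    separator-expansion : ∀ σ → FallingExpansion D (separator σ)
    separator-expansion true = expP
    separator-expansion false = expQ

    separator-separates : ∀ σ → Separates n F σ (separator σ)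
    separator-separates true = sepP
    separator-separates false = sepQ

    -- N is the least number with 2N > (D+1)·2D, the degree of u ↦ G(L + σu²)^(D+1); then 2N+1 < 9^(D+1).
    N W : ℕ
    N = suc (suc D ℕ.* D)
    W = N ℕ.* N

    2rD<2N : suc D ℕ.* (D ℕ.* 2) ℕ.< N ℕ.+ N
    2rD<2N = ℕ.≤-trans (ℕ.m≤m+n _ 1) (ℕ.≤-reflexive (expand D))
      where
      expand : ∀ D → suc (suc D ℕ.* (D ℕ.* 2)) ℕ.+ 1 ≡ suc (suc D ℕ.* D) ℕ.+ suc (suc D ℕ.* D)
      expand = solve-∀

    no-isolated-value : ∀ L σ → L ℕ.≤ n →
      ¬ (∀ m → 1 ℕ.≤ m → m ℕ.≤ N → ∃ λ j → j ℕ.≤ n × F j ≢ F L × ⟦ L ⟧ + σ * (⟦ m ⟧ * ⟦ m ⟧) ≡ ⟦ j ⟧)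
    no-isolated-value L σ L≤n nodes = <-irrefl refl (<-≤-trans (⟦⟧*ninth^r<1 (suc (N ℕ.+ N)) (suc D) (1+2N<9^[1+D] D))
      (extrapolation-at-squares D G (separator-expansion (F L)) ⟦ L ⟧ σ (suc D) N 2rD<2N ninth 0≤ninth small-at-nodes
        (large L L≤n refl)))
      where
      G = separator (F L)
      open Separates (separator-separates (F L))
      small-at-nodes : ∀ m → 1 ℕ.≤ m → m ℕ.≤ N → Small (G (⟦ L ⟧ + σ * (⟦ m ⟧ * ⟦ m ⟧)))
      small-at-nodes m 1≤m m≤N with nodes m 1≤m m≤N
      ... | j , j≤n , Fj≢FL , node≡j = subst (Small ∘ G) (sym node≡j) (small j j≤n Fj≢FL)

    m*m≤W : ∀ {m} → m ℕ.≤ N → m ℕ.* m ℕ.≤ W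
    m*m≤W m≤N = ℕ.*-mono-≤ m≤N m≤N

    1≤m*m : ∀ {m} → 1 ℕ.≤ m → 1 ℕ.≤ m ℕ.* m
    1≤m*m 1≤m = ℕ.*-mono-≤ 1≤m 1≤m

    backward-run : ∀ L → L ℕ.≤ n → W ℕ.≤ L → ¬ (∀ j → L ℕ.∸ W ℕ.≤ j → j ℕ.< L → F j ≢ F L)
    backward-run L L≤n W≤L differ = no-isolated-value L (- 1ℚ) L≤n (λ m 1≤m m≤N →
      let m²≤L = ℕ.≤-trans (m*m≤W m≤N) W≤L in
      L ℕ.∸ m ℕ.* m ,
      ℕ.≤-trans (ℕ.m∸n≤m L (m ℕ.* m)) L≤n ,
      differ (L ℕ.∸ m ℕ.* m) (ℕ.∸-monoʳ-≤ L (m*m≤W m≤N)) (ℕ.∸-monoʳ-< {L} {m ℕ.* m} {0} (1≤m*m 1≤m) m²≤L) ,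
      (begin
        ⟦ L ⟧ + - 1ℚ * (⟦ m ⟧ * ⟦ m ⟧)
      ≡⟨ cong₂ (λ l m² → l + - 1ℚ * m²) (sym (⟦⟧-homo-∸ m²≤L)) (sym (⟦⟧-homo-* m m)) ⟩
        ⟦ L ℕ.∸ m ℕ.* m ⟧ + ⟦ m ℕ.* m ⟧ + - 1ℚ * ⟦ m ℕ.* m ⟧
      ≡⟨ solve 2 (λ a b → a :+ b :+ con (- 1ℚ) :* b := a) refl ⟦ L ℕ.∸ m ℕ.* m ⟧ ⟦ m ℕ.* m ⟧ ⟩
        ⟦ L ℕ.∸ m ℕ.* m ⟧
      ∎))
      where open ≡-Reasoning

    forward-run : ∀ L → L ℕ.+ W ℕ.≤ n → ¬ (∀ j → L ℕ.< j → j ℕ.≤ L ℕ.+ W → F j ≢ F L)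
    forward-run L L+W≤n differ = no-isolated-value L 1ℚ (ℕ.≤-trans (ℕ.m≤m+n L W) L+W≤n) (λ m 1≤m m≤N →
      L ℕ.+ m ℕ.* m ,
      ℕ.≤-trans (ℕ.+-monoʳ-≤ L (m*m≤W m≤N)) L+W≤n ,
      differ (L ℕ.+ m ℕ.* m) (ℕ.≤-trans (ℕ.≤-reflexive (ℕ.+-comm 1 L)) (ℕ.+-monoʳ-≤ L (1≤m*m 1≤m))) (ℕ.+-monoʳ-≤ L (m*m≤W m≤N)) ,
      trans (cong (⟦ L ⟧ +_) (trans (*-identityˡ _) (sym (⟦⟧-homo-* m m)))) (sym (⟦⟧-homo-+ L (m ℕ.* m))))

    R : ℚ → ℚ
    R y = P y - Q y

    deg-R : Deg≤ (D ℕ.* 1) R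
    deg-R = deg-- (D ℕ.* 1) {P} {Q} (deg-∘ D 1 expP deg-id) (deg-∘ D 1 expQ deg-id)

    sign-R : ∀ k → k ℕ.≤ n → HasSign (F k) (R ⟦ k ⟧)
    sign-R k k≤n with F k in Fk
    ... | true = q<p⇒0<p-q (≤-<-trans (proj₂ (Separates.small sepQ k k≤n (not-¬ Fk)))
                                      (<-≤-trans ninth<1 (Separates.large sepP k k≤n Fk)))
    ... | false = p<q⇒p-q<0 (≤-<-trans (proj₂ (Separates.small sepP k k≤n (not-¬ Fk)))
                                       (<-≤-trans ninth<1 (Separates.large sepQ k k≤n Fk)))

    changes≤D : ∀ {s a σ} → Alternation R (suc s) a σ → suc s ℕ.≤ D
    changes≤D {s} alternation = decidable-stable (suc s ℕ.≤? D) λ 1+s≰D →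
      deg-no-alternation s R (deg-mono (ℕ.≤-trans (ℕ.≤-reflexive (ℕ.*-identityʳ D)) (ℕ.≤-pred (ℕ.≰⇒> 1+s≰D))) deg-R)
                         _ _ alternation

    constant⊎short : (∀ k → k ℕ.≤ n → F k ≡ F 0) ⊎ (1 ℕ.≤ D × n ℕ.< suc D ℕ.* W)
    constant⊎short = Sum.map₂ short (Runs.constant⊎alternation n W F R sign-R backward-run forward-run)
      where
      short : (∃ λ s → Alternation R (suc s) 0 (F 0) × n ℕ.< suc (suc s) ℕ.* W) → 1 ℕ.≤ D × n ℕ.< suc D ℕ.* W
      short (s , alternation , n<[2+s]W) = ℕ.≤-trans (s≤s z≤n) (changes≤D alternation) ,
                                          ℕ.<-≤-trans n<[2+s]W (ℕ.*-monoˡ-≤ W (s≤s (changes≤D alternation)))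

  squared : ∀ {n} → Poly n → CubeFn n
  squared p x = evalPoly p x * evalPoly p x

  separates-by-squares : ∀ {n} (F : ℕ → Bool) σ (h : BoolFun n) (p : Poly n) → NRepresents p h →
    (∀ x → F (weight x) ≡ σ → h x ≡ true) → (∀ x → F (weight x) ≢ σ → h x ≡ false) →
    Separates n F σ (symmetrize n (squared p))
  separates-by-squares {n} F σ h p represents positive negative = record
    { large = λ k k≤n Fk≡σ → symmetrize-convex (1ℚ ≤_) (≥-convex 1ℚ) n (squared p) k k≤n
        (λ x wx≡k → 1≤∣p∣⇒1≤p*p (proj₂ (represents x) (positive x (trans (cong F wx≡k) Fk≡σ))))
    ; small = λ k k≤n Fk≢σ →
        symmetrize-convex (0ℚ ≤_) (≥-convex 0ℚ) n (squared p) k k≤n (λ x _ → 0≤p*p (evalPoly p x)) ,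
        symmetrize-convex (_≤ ninth) (≤-convex ninth) n (squared p) k k≤n
          (λ x wx≡k → ∣p∣≤q⇒p*p≤q*q (proj₁ (represents x) (negative x (λ Fwx≡σ → Fk≢σ (trans (cong F (sym wx≡k)) Fwx≡σ)))))
    }

  NDegAtMost-mono : ∀ {n} {f : BoolFun n} {d d′} → d ℕ.≤ d′ → NDegAtMost f d → NDegAtMost f d′
  NDegAtMost-mono d≤d′ (p , deg-p , represents) = p , (λ S d′<wS → deg-p S (ℕ.≤-<-trans d≤d′ d′<wS)) , represents

  ones : ∀ n → ℕ → Input n
  ones zero k = []
  ones (suc n) zero = false ∷ ones n zero
  ones (suc n) (suc k) = true ∷ ones n k

  weight-ones : ∀ n k → k ℕ.≤ n → weight (ones n k) ≡ k
  weight-ones zero zero _ = refl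
  weight-ones (suc n) zero _ = weight-ones n zero z≤n
  weight-ones (suc n) (suc k) (s≤s k≤n) = cong suc (weight-ones n k k≤n)

  weight≤n : ∀ {n} (x : Input n) → weight x ℕ.≤ n
  weight≤n [] = z≤n
  weight≤n (true ∷ x) = s≤s (weight≤n x)
  weight≤n (false ∷ x) = ℕ.m≤n⇒m≤1+n (weight≤n x)

  symmetric-by-weight : ∀ {n} {f : BoolFun n} → Symmetric f → ∀ x → f x ≡ f (ones n (weight x))
  symmetric-by-weight {n} sym-f x = sym-f x (ones n (weight x)) (sym (weight-ones n (weight x) (weight≤n x)))

  bound : ℕ → ℕ
  bound d = suc (d ℕ.+ d) ℕ.* (N ℕ.* N)
    where N = suc (suc (d ℕ.+ d) ℕ.* (d ℕ.+ d))

  constant⊎bounded : ∀ n (f : BoolFun n) → Symmetric f → ∀ d → NDegAtMost f d → NDegAtMost (complement f) d →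
    (∃ λ b → ∀ x → f x ≡ b) ⊎ (1 ℕ.≤ d ℕ.+ d × n ℕ.< bound d)
  constant⊎bounded n f sym-f d (p , deg-p , represents-p) (q , deg-q , represents-q) =
    Sum.map₁ (λ constant → F 0 , λ x → trans (f≡F x) (constant (weight x) (weight≤n x)))
      (Separated.constant⊎short n F (d ℕ.+ d) (symmetrize n (squared p)) (symmetrize n (squared q))
        (symmetrize-expansion (d ℕ.+ d) n (squared p) (mdeg≤-* d d n (evalPoly-mdeg≤ d n p deg-p) (evalPoly-mdeg≤ d n p deg-p)))
        (symmetrize-expansion (d ℕ.+ d) n (squared q) (mdeg≤-* d d n (evalPoly-mdeg≤ d n q deg-q) (evalPoly-mdeg≤ d n q deg-q)))
        (separates-by-squares F true f p represents-p (λ x → trans (f≡F x)) (λ x Fwx≢true → trans (f≡F x) (¬-not Fwx≢true)))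
        (separates-by-squares F false (complement f) q represents-q (λ x Fwx≡false → cong not (trans (f≡F x) Fwx≡false))
                              (λ x Fwx≢false → cong not (trans (f≡F x) (¬-not Fwx≢false)))))
    where
    F : ℕ → Bool
    F k = f (ones n k)
    f≡F : ∀ x → f x ≡ F (weight x)
    f≡F = symmetric-by-weight sym-f

  bound≤147*d^6 : ∀ d → 1 ℕ.≤ d ℕ.+ d → bound d ℕ.≤ 147 ℕ.* d ℕ.^ 6
  bound≤147*d^6 zero ()
  bound≤147*d^6 (suc u) _ = ℕ.≤-trans (ℕ.*-mono-≤ 1+2d≤3d (ℕ.*-mono-≤ N≤7d² N≤7d²))
    (ℕ.≤-trans (ℕ.≤-reflexive (product d))
      (ℕ.*-monoʳ-≤ 147 (ℕ.≤-trans (ℕ.≤-reflexive (sym (ℕ.*-identityˡ (d ℕ.^ 5)))) (ℕ.*-monoˡ-≤ (d ℕ.^ 5) 1≤d))))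
    where
    d = suc u
    1≤d : 1 ℕ.≤ d
    1≤d = s≤s z≤n
    1+2d≤3d : suc (d ℕ.+ d) ℕ.≤ 3 ℕ.* d
    1+2d≤3d = ℕ.≤-trans (ℕ.+-monoˡ-≤ (d ℕ.+ d) 1≤d) (ℕ.≤-reflexive (three d))
      where
      three : ∀ d → d ℕ.+ (d ℕ.+ d) ≡ 3 ℕ.* d
      three = solve-∀
    N≤7d² : suc (suc (d ℕ.+ d) ℕ.* (d ℕ.+ d)) ℕ.≤ 7 ℕ.* (d ℕ.* d)
    N≤7d² = ℕ.≤-trans (ℕ.+-mono-≤ (ℕ.*-mono-≤ 1≤d 1≤d) (ℕ.*-monoˡ-≤ (d ℕ.+ d) 1+2d≤3d)) (ℕ.≤-reflexive (seven d))
      where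
      seven : ∀ d → d ℕ.* d ℕ.+ 3 ℕ.* d ℕ.* (d ℕ.+ d) ≡ 7 ℕ.* (d ℕ.* d)
      seven = solve-∀
    product : ∀ d → 3 ℕ.* d ℕ.* (7 ℕ.* (d ℕ.* d) ℕ.* (7 ℕ.* (d ℕ.* d))) ≡ 147 ℕ.* (d ℕ.* (d ℕ.* (d ℕ.* (d ℕ.* (d ℕ.* 1)))))
    product = solve-∀

module DecisionTrees where

  open import Data.Bool using (true; false; if_then_else_)
  open import Data.Fin as Fin using ()
  open import Data.Nat as ℕ using (ℕ; zero; suc; z≤n; s≤s)
  import Data.Nat.Properties as ℕ
  open import Data.Product using (_,_)
  open import Data.Vec using ([]; _∷_; lookup)
  open import Defs
  open import Relation.Binary.PropositionalEquality

  lift : ∀ {n} → DTree n → DTree (suc n)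
  lift (leaf b) = leaf b
  lift (query i t₀ t₁) = query (Fin.suc i) (lift t₀) (lift t₁)

  runTree-lift : ∀ {n} (t : DTree n) b x → runTree (lift t) (b ∷ x) ≡ runTree t x
  runTree-lift (leaf c) b x = refl
  runTree-lift (query i t₀ t₁) b x = cong₂ (if lookup x i then_else_) (runTree-lift t₁ b x) (runTree-lift t₀ b x)

  depth-lift : ∀ {n} (t : DTree n) → depth (lift t) ≡ depth t
  depth-lift (leaf b) = refl
  depth-lift (query i t₀ t₁) = cong₂ (λ u v → suc (u ℕ.⊔ v)) (depth-lift t₀) (depth-lift t₁)

  DAtMost-mono : ∀ {n} {f : BoolFun n} {k k′} → k ℕ.≤ k′ → DAtMost f k → DAtMost f k′
  DAtMost-mono k≤k′ (t , computes , depth≤k) = t , computes , ℕ.≤-trans depth≤k k≤k′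

  DAtMost-constant : ∀ {n} {f : BoolFun n} b → (∀ x → f x ≡ b) → DAtMost f 0
  DAtMost-constant b f≡b = leaf b , (λ x → sym (f≡b x)) , z≤n

  DAtMost-n : ∀ n (f : BoolFun n) → DAtMost f n
  DAtMost-n zero f = DAtMost-constant (f []) (λ { [] → refl })
  DAtMost-n (suc n) f with DAtMost-n n (λ x → f (false ∷ x)) | DAtMost-n n (λ x → f (true ∷ x))
  ... | t₀ , computes₀ , depth₀ | t₁ , computes₁ , depth₁ = query Fin.zero (lift t₀) (lift t₁) , computes ,
        s≤s (ℕ.⊔-lub (ℕ.≤-trans (ℕ.≤-reflexive (depth-lift t₀)) depth₀) (ℕ.≤-trans (ℕ.≤-reflexive (depth-lift t₁)) depth₁))
    where
    computes : Computes (query Fin.zero (lift t₀) (lift t₁)) f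
    computes (true ∷ x) = trans (runTree-lift t₁ true x) (computes₁ x)
    computes (false ∷ x) = trans (runTree-lift t₀ false x) (computes₀ x)

open import Defs
open import Data.Nat using (ℕ; _*_; _^_; _⊔_)
open import Data.Product using (∃)

corollary6 : ∃ λ (C : ℕ) →
    (n : ℕ) (f : BoolFun n) → Symmetric f →
    (d₁ d₂ : ℕ) → NDegAtMost f d₁ → NDegAtMost (complement f) d₂ →
    DAtMost f (C * ((d₁ ⊔ d₂) ^ 6))
corollary6 = 147 , λ n f sym-f d₁ d₂ N-f N-f̄ →
  [ (λ { (b , f≡b) → DAtMost-mono z≤n (DAtMost-constant b f≡b) })
  , (λ { (1≤2d , n<bound) → DAtMost-mono (≤-trans (<⇒≤ n<bound) (bound≤147*d^6 (d₁ ⊔ d₂) 1≤2d)) (DAtMost-n n f) })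
  ]′ (constant⊎bounded n f sym-f (d₁ ⊔ d₂) (NDegAtMost-mono (m≤m⊔n d₁ d₂) N-f) (NDegAtMost-mono (m≤n⊔m d₁ d₂) N-f̄))
  where
  open import Data.Nat using (z≤n)
  open import Data.Nat.Properties using (≤-trans; <⇒≤; m≤m⊔n; m≤n⊔m)
  open import Data.Product using (_,_)
  open import Data.Sum using ([_,_]′)
  open DecisionTrees
  open SymmetricFunctions using (NDegAtMost-mono; constant⊎bounded; bound≤147*d^6)
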